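{- Let $r,n$ be positive integers with $n\geq r$, let $s,d\in\mathbb{N}$ with $0\leq d\leq\lfloor s/r\rfloor$, let $\mathbf a\in\mathbb{N}^n$ with $|\mathbf a|=s-rd$, and let $u=n-r+1$. Then \[ |K(r,n,\mathbf a,d)|=\sum_{j=0}^{n}\binom{d+j}{j}\sigma_{n-j}(\mathbf a)+\sum_{i=1}^{\lfloor d/u\rfloor}\sum_{j=u+1}^{n}\left(\binom{d-ui+j}{j}-\binom{d-ui+u}{j}\right)\sigma_{n-j}(\mathbf a+i\mathbf 1). \] Moreover, for fixed $n,r,d$ and $|\mathbf a|$, this size is maximized if and only if $\mathbf a$ is a balanced partition.
   Context: $\mathbb{N}=\{0,1,2,\ldots\}$; $|\mathbf a|=\sum_i a_i$; $\mathbf 1=(1,\ldots,1)$; $[n]=\{1,\ldots,n\}$. $\sigma_k(\mathbf a)=\sum_{S\subset[n],|S|=k}\prod_{i\in S}a_i$ is the $k$-th elementary symmetric polynomial of $a_1,\ldots,a_n$ (with $\sigma_0=1$). Write $\mathbf a\prec\mathbf b$ if $a_i\leq b_i$ for all $i$; $\mathcal{D}(\mathbf a)=\{\mathbf c\in\mathbb{N}^n:\mathbf c\prec\mathbf a\}$, $\mathcal{D}(B)=\bigcup_{\mathbf a\in B}\mathcal{D}(\mathbf a)$; $\mathcal{U}(\mathbf a,d)=\{\mathbf a+\boldsymbol\epsilon:\boldsymbol\epsilon\in\mathbb{N}^n,|\boldsymbol\epsilon|=d\}$. $K(r,n,\mathbf a,d)=\bigcup_{i=0}^{\lfloor d/u\rfloor}\mathcal{D}(\mathcal{U}(\mathbf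 a+i\mathbf 1,d-ui))$. A vector $\mathbf a\in\mathbb{N}^n$ is a balanced partition if $|a_i-a_j|\leq1$ for all $i,j$. -}

module Defs where

open import Data.Nat using (ℕ; zero; suc; _+_; _*_; _∸_; _≤_; _≟_)
open import Data.Nat.DivMod using (_/_)
open import Data.Nat.Combinatorics using (_C_)
open import Data.Bool using (Bool; true; false)
open import Data.List as List using (List; []; _∷_; upTo; map; length; filter; concatMap)
open import Data.Nat.ListAction using (sum)
open import Data.List.Membership.Propositional using (_∈_)
open import Data.List.Relation.Unary.Unique.Propositional using (Unique)
open import Data.Vec as Vec using (Vec; []; _∷_)
open import Data.Vec.Relation.Binary.Pointwise.Inductive using (Pointwise)
open import Data.Product using (Σ; ∃; _×_; _,_)
open import Function.Bundles using (_⇔_)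
open import Relation.Binary.PropositionalEquality using (_≡_)

∣_∣ᵥ : {n : ℕ} → Vec ℕ n → ℕ
∣ a ∣ᵥ = Vec.sum a

_+𝟏_ : {n : ℕ} → Vec ℕ n → ℕ → Vec ℕ n
a +𝟏 i = Vec.map (i +_) a

_≺_ : {n : ℕ} → Vec ℕ n → Vec ℕ n → Set
c ≺ a = Pointwise _≤_ c a

allSubsets : (n : ℕ) → List (Vec Bool n)
allSubsets zero = [] ∷ []
allSubsets (suc n) = concatMap (λ S → (true ∷ S) ∷ (false ∷ S) ∷ []) (allSubsets n)

card : {n : ℕ} → Vec Bool n → ℕ
card [] = 0
card (true ∷ S) = suc (card S)
card (false ∷ S) = card S

prodOn : {n : ℕ} → Vec Bool n → Vec ℕ n → ℕ
prodOn [] [] = 1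
prodOn (true ∷ S) (x ∷ a) = x * prodOn S a
prodOn (false ∷ S) (x ∷ a) = prodOn S a

σ : {n : ℕ} → ℕ → Vec ℕ n → ℕ
σ {n} k a = sum (map (λ S → prodOn S a) (filter (λ S → card S ≟ k) (allSubsets n)))

-- ∑_{j=lo}^{hi} f j  (empty if hi < lo)
∑[_,_] : ℕ → ℕ → (ℕ → ℕ) → ℕ
∑[ lo , hi ] f = sum (map (λ t → f (lo + t)) (upTo (suc hi ∸ lo)))

uOf : ℕ → ℕ → ℕ
uOf r n = suc (n ∸ r)

-- membership in K(r,n,a,d) = ⋃_{i=0}^{⌊d/u⌋} D(U(a + i·1, d - u·i))
InK : (r n : ℕ) → Vec ℕ n → ℕ → Vec ℕ n → Set
InK r n a d c =
  Σ ℕ λ i → i ≤ d / uOf r n ×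
    Σ (Vec ℕ n) λ ε → ∣ ε ∣ᵥ ≡ d ∸ uOf r n * i × c ≺ Vec.zipWith _+_ (a +𝟏 i) ε

-- the set K(r,n,a,d) is finite of cardinality m: it is enumerated by a duplicate-free list of length m
KHasSize : (r n : ℕ) → Vec ℕ n → ℕ → ℕ → Set
KHasSize r n a d m =
  Σ (List (Vec ℕ n)) λ xs → Unique xs × (∀ c → (c ∈ xs) ⇔ InK r n a d c) × length xs ≡ m

-- right-hand side of the size formula (the differences of binomials are nonnegative since j > u)
Kformula : (r n : ℕ) → Vec ℕ n → ℕ → ℕ
Kformula r n a d =
  ∑[ 0 , n ] (λ j → ((d + j) C j) * σ (n ∸ j) a)
  + ∑[ 1 , d / uOf r n ] (λ i →
      ∑[ suc (uOf r n) , n ] (λ j →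
        (((d ∸ uOf r n * i) + j) C j ∸ ((d ∸ uOf r n * i) + uOf r n) C j) * σ (n ∸ j) (a +𝟏 i)))

Balanced : {n : ℕ} → Vec ℕ n → Set
Balanced {n} a = ∀ i j → Vec.lookup a i ≤ suc (Vec.lookup a j)

module Submission where

-- Write u = n − r + 1, I = ⌊d/u⌋ and overflow(b, c) = Σₖ (cₖ ∸ bₖ).  A point c lies
-- in D(U(b, E)) iff overflow(b, c) ≤ E, so c ∈ K iff the layer functional
-- gᵢ(c) = overflow(a + i𝟏, c) + u·i is at most d for some i ≤ I; hence K is a
-- filtered sublist of the box D(a + d𝟏).  As a function of i, gᵢ is convex, so the
-- good layers form an interval and the indicator of K is a sum over layers of a
-- test depending only on reach(a + i𝟏, c) = #{k : aₖ + i ≤ cₖ} and overflow(a + i𝟏, c).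
-- Summing such a test over a box factorises over the coordinates: the result is
-- ∏ₖ (bₖ + X) evaluated at Xʰ ↦ (a sum over h-tuples of bounded entries), which
-- is Σⱼ (weight j)·σ_{n−j}(b).  Stars and bars and the hockey-stick identity make
-- the weights binomial, so |K| = G(a) := Σ_{i ≤ I} prodEval(a + i𝟏, layerWeight i),
-- and G(a) is Kformula.
--
-- For the maximisation, moving one unit from an entry x to an entry y < x keeps the
-- sum and does not decrease xy, hence does not decrease G, and increases G strictly
-- when y + 1 < x.  So an unbalanced vector is not maximal, and a balanced a beats
-- every b of the same sum, by induction on the surplus Σₖ (bₖ ∸ aₖ).

open import Defs
open import Data.Nat using (ℕ; _*_; _∸_; _≤_; _≥_; _/_; NonZero)
open import Data.Vec using (Vec)
open import Data.Product using (_×_)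
open import Function.Bundles using (_⇔_)
open import Relation.Binary.PropositionalEquality using (_≡_)

open import Data.Nat.Base
open import Data.Nat.Properties
open import Data.Nat.Combinatorics using (_C_; nCk+nC[k+1]≡[n+1]C[k+1]; nCn≡1; k>n⇒nCk≡0)
open import Data.Nat.DivMod using (m/n*n≤m)
open import Data.Nat.ListAction using (sum)
open import Data.Nat.ListAction.Properties using (sum-++)
open import Data.Nat.Tactic.RingSolver using (solve-∀)
import Algebra.Properties.CommutativeSemigroup +-commutativeSemigroup as +-Comm
open import Data.Bool.Base using (Bool; true; false; T; not; _∨_; if_then_else_)
open import Data.Bool.Properties using (T?; T-∨)
open import Data.Empty using (⊥-elim)
open import Data.Unit.Base using (tt)
open import Data.Fin.Base using (Fin; zero; suc)
open import Data.List.Base using (List; []; _∷_; _++_; map; upTo; filter; length; concatMap; cartesianProductWith; applyUpTo)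
open import Data.List.Properties using (map-++; map-∘; map-upTo)
open import Data.Vec.Base as Vec using ([]; _∷_; toList; lookup; updateAt)
open import Data.Product using (Σ; _,_)
open import Function.Base using (_∘_; _∘′_)
open import Function.Bundles using (Equivalence; mk⇔)
open import Data.Sum.Base using (inj₁; inj₂)
open import Data.Vec.Properties using (∷-injective; map-id; toList-map; lookup∘updateAt′)
open import Data.Vec.Relation.Binary.Pointwise.Inductive using (Pointwise; []; _∷_)
open import Data.List.Membership.Propositional using (_∈_)
open import Data.List.Membership.Propositional.Properties using (∈-filter⁺; ∈-filter⁻; ∈-cartesianProductWith⁺; ∈-upTo⁺)
open import Data.List.Relation.Unary.Any using (here)
open import Data.List.Membership.Propositional.Properties.WithK using (unique∧set⇒bag)
open import Data.List.Relation.Binary.BagAndSetEquality using (∼bag⇒↭)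
open import Data.List.Relation.Binary.Permutation.Propositional.Properties using (↭-length)
open import Data.List.Relation.Unary.All using ([])
open import Data.List.Relation.Unary.AllPairs using ([]; _∷_)
open import Data.List.Relation.Unary.Unique.Propositional using (Unique)
open import Data.List.Relation.Unary.Unique.Propositional.Properties using (filter⁺; cartesianProductWith⁺; upTo⁺)
open import Relation.Nullary using (¬_; Dec; yes; no; does)
open import Relation.Binary.PropositionalEquality using (refl; sym; trans; cong; cong₂; subst; subst₂; _≢_; module ≡-Reasoning)

open ≡-Reasoning

∑< : ℕ → (ℕ → ℕ) → ℕ
∑< zero    f = 0
∑< (suc n) f = f 0 + ∑< n (λ t → f (suc t))

∑<-cong : ∀ n {f g : ℕ → ℕ} → (∀ t → t < n → f t ≡ g t) → ∑< n f ≡ ∑< n g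
∑<-cong zero    eq = refl
∑<-cong (suc n) eq = cong₂ _+_ (eq 0 z<s) (∑<-cong n (λ t t<n → eq (suc t) (s<s t<n)))

∑<-zero : ∀ n {f : ℕ → ℕ} → (∀ t → t < n → f t ≡ 0) → ∑< n f ≡ 0
∑<-zero zero    eq = refl
∑<-zero (suc n) eq = cong₂ _+_ (eq 0 z<s) (∑<-zero n (λ t t<n → eq (suc t) (s<s t<n)))

∑<-mono : ∀ n {f g : ℕ → ℕ} → (∀ t → f t ≤ g t) → ∑< n f ≤ ∑< n g
∑<-mono zero    le = ≤-refl
∑<-mono (suc n) le = +-mono-≤ (le 0) (∑<-mono n (λ t → le (suc t)))

∑<-+ : ∀ n (f g : ℕ → ℕ) → ∑< n (λ t → f t + g t) ≡ ∑< n f + ∑< n g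
∑<-+ zero    f g = refl
∑<-+ (suc n) f g = trans (cong (f 0 + g 0 +_) (∑<-+ n (f ∘ suc) (g ∘ suc))) (+-Comm.interchange (f 0) (g 0) _ _)

∑<-* : ∀ n k (f : ℕ → ℕ) → ∑< n (λ t → k * f t) ≡ k * ∑< n f
∑<-* zero    k f = sym (*-zeroʳ k)
∑<-* (suc n) k f = trans (cong (k * f 0 +_) (∑<-* n k (f ∘ suc))) (sym (*-distribˡ-+ k (f 0) _))

∑<-const : ∀ n c → ∑< n (λ _ → c) ≡ n * c
∑<-const zero    c = refl
∑<-const (suc n) c = cong (c +_) (∑<-const n c)

∑<-split : ∀ m n (f : ℕ → ℕ) → ∑< (m + n) f ≡ ∑< m f + ∑< n (λ t → f (m + t))
∑<-split zero    n f = refl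
∑<-split (suc m) n f = trans (cong (f 0 +_) (∑<-split m n (f ∘ suc))) (sym (+-assoc (f 0) _ _))

∑<-last : ∀ n (f : ℕ → ℕ) → ∑< (suc n) f ≡ ∑< n f + f n
∑<-last n f = begin
  ∑< (suc n) f                ≡⟨ cong (λ k → ∑< k f) (+-comm 1 n) ⟩
  ∑< (n + 1) f                ≡⟨ ∑<-split n 1 f ⟩
  ∑< n f + (f (n + 0) + 0)    ≡⟨ cong (∑< n f +_) (trans (+-identityʳ _) (cong f (+-identityʳ n))) ⟩
  ∑< n f + f n                ∎

∑<-reverse : ∀ n (f : ℕ → ℕ) → ∑< n f ≡ ∑< n (λ k → f (n ∸ suc k))
∑<-reverse zero    f = refl
∑<-reverse (suc n) f = begin
  f 0 + ∑< n (f ∘ suc)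
    ≡⟨ cong (f 0 +_) (∑<-reverse n (f ∘ suc)) ⟩
  f 0 + ∑< n (λ k → f (suc (n ∸ suc k)))
    ≡⟨ +-comm (f 0) _ ⟩
  ∑< n (λ k → f (suc (n ∸ suc k))) + f 0
    ≡⟨ cong₂ _+_ (∑<-cong n (λ k k<n → cong f (sym (+-∸-assoc 1 k<n)))) (cong f (sym (n∸n≡0 n))) ⟩
  ∑< n (λ k → f (n ∸ k)) + f (n ∸ n)
    ≡⟨ sym (∑<-last n (λ k → f (n ∸ k))) ⟩
  ∑< (suc n) (λ k → f (n ∸ k)) ∎

∑<-drop : ∀ n k (f : ℕ → ℕ) → (∀ j → j < k → f j ≡ 0) → ∑< n f ≡ ∑< (n ∸ k) (λ t → f (k + t))
∑<-drop n k f vanish with k ≤? n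
... | yes k≤n = begin
  ∑< n f                                  ≡⟨ cong (λ m → ∑< m f) (sym (m+[n∸m]≡n k≤n)) ⟩
  ∑< (k + (n ∸ k)) f                      ≡⟨ ∑<-split k (n ∸ k) f ⟩
  ∑< k f + ∑< (n ∸ k) (λ t → f (k + t))   ≡⟨ cong (_+ ∑< (n ∸ k) (λ t → f (k + t))) (∑<-zero k vanish) ⟩
  ∑< (n ∸ k) (λ t → f (k + t))            ∎
... | no k≰n = begin
  ∑< n f                          ≡⟨ ∑<-zero n (λ j j<n → vanish j (<-trans j<n (≰⇒> k≰n))) ⟩
  0                               ≡⟨ cong (λ m → ∑< m (λ t → f (k + t))) (sym (m≤n⇒m∸n≡0 (<⇒≤ (≰⇒> k≰n)))) ⟩
  ∑< (n ∸ k) (λ t → f (k + t))    ∎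

sum-map-cong : ∀ {A : Set} (xs : List A) {f g : A → ℕ} → (∀ x → f x ≡ g x) → sum (map f xs) ≡ sum (map g xs)
sum-map-cong []       eq = refl
sum-map-cong (x ∷ xs) eq = cong₂ _+_ (eq x) (sum-map-cong xs eq)

sum-map-zero : ∀ {A : Set} (xs : List A) {f : A → ℕ} → (∀ x → f x ≡ 0) → sum (map f xs) ≡ 0
sum-map-zero []       eq = refl
sum-map-zero (x ∷ xs) eq = cong₂ _+_ (eq x) (sum-map-zero xs eq)

sum-map-+ : ∀ {A : Set} (xs : List A) (f g : A → ℕ) → sum (map (λ x → f x + g x) xs) ≡ sum (map f xs) + sum (map g xs)
sum-map-+ []       f g = refl
sum-map-+ (x ∷ xs) f g = begin
  f x + g x + sum (map (λ x → f x + g x) xs)        ≡⟨ cong (f x + g x +_) (sum-map-+ xs f g) ⟩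
  f x + g x + (sum (map f xs) + sum (map g xs))     ≡⟨ +-Comm.interchange (f x) (g x) _ _ ⟩
  f x + sum (map f xs) + (g x + sum (map g xs))     ∎

sum-map-* : ∀ {A : Set} (xs : List A) k (f : A → ℕ) → sum (map (λ x → k * f x) xs) ≡ k * sum (map f xs)
sum-map-* []       k f = sym (*-zeroʳ k)
sum-map-* (x ∷ xs) k f = trans (cong (k * f x +_) (sum-map-* xs k f)) (sym (*-distribˡ-+ k (f x) _))

sum-map-∑< : ∀ {A : Set} (xs : List A) n (f : A → ℕ → ℕ) →
  sum (map (λ x → ∑< n (f x)) xs) ≡ ∑< n (λ i → sum (map (λ x → f x i) xs))
sum-map-∑< []       n f = sym (∑<-zero n (λ _ _ → refl))
sum-map-∑< (x ∷ xs) n f = trans (cong (∑< n (f x) +_) (sum-map-∑< xs n f)) (sym (∑<-+ n (f x) _))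

sum-map-upTo : ∀ k (g : ℕ → ℕ) → sum (map g (upTo k)) ≡ ∑< k g
sum-map-upTo k g = trans (cong sum (map-upTo g k)) (sum-applyUpTo k g)
  where
  sum-applyUpTo : ∀ k (g : ℕ → ℕ) → sum (applyUpTo g k) ≡ ∑< k g
  sum-applyUpTo zero    g = refl
  sum-applyUpTo (suc k) g = cong (g 0 +_) (sum-applyUpTo k (g ∘ suc))

sum-map-cartesianProductWith : ∀ {A B C : Set} (h : A → B → C) (xs : List A) (ys : List B) (f : C → ℕ) →
  sum (map f (cartesianProductWith h xs ys)) ≡ sum (map (λ x → sum (map (λ y → f (h x y)) ys)) xs)
sum-map-cartesianProductWith h []       ys f = refl
sum-map-cartesianProductWith h (x ∷ xs) ys f = begin
  sum (map f (map (h x) ys ++ cartesianProductWith h xs ys))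
    ≡⟨ cong sum (map-++ f (map (h x) ys) _) ⟩
  sum (map f (map (h x) ys) ++ map f (cartesianProductWith h xs ys))
    ≡⟨ sum-++ (map f (map (h x) ys)) _ ⟩
  sum (map f (map (h x) ys)) + sum (map f (cartesianProductWith h xs ys))
    ≡⟨ cong₂ _+_ (cong sum (sym (map-∘ ys))) (sum-map-cartesianProductWith h xs ys f) ⟩
  sum (map (λ y → f (h x y)) ys) + sum (map (λ x → sum (map (λ y → f (h x y)) ys)) xs) ∎

𝟙 : Bool → ℕ
𝟙 true  = 1
𝟙 false = 0

𝟙-true : ∀ {b} → T b → 𝟙 b ≡ 1
𝟙-true {true} _ = refl

𝟙-false : ∀ {b} → ¬ T b → 𝟙 b ≡ 0
𝟙-false {true}  ¬t = ⊥-elim (¬t tt)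
𝟙-false {false} _  = refl

𝟙-≤ᵇ-yes : ∀ {m n} → m ≤ n → 𝟙 (m ≤ᵇ n) ≡ 1
𝟙-≤ᵇ-yes m≤n = 𝟙-true (≤⇒≤ᵇ m≤n)

𝟙-≤ᵇ-no : ∀ {m n} → n < m → 𝟙 (m ≤ᵇ n) ≡ 0
𝟙-≤ᵇ-no {m} {n} n<m = 𝟙-false (λ t → <⇒≱ n<m (≤ᵇ⇒≤ m n t))

𝟙-≤ᵇ-cong : ∀ {m n m′ n′} → (m ≤ n → m′ ≤ n′) → (m′ ≤ n′ → m ≤ n) → 𝟙 (m ≤ᵇ n) ≡ 𝟙 (m′ ≤ᵇ n′)
𝟙-≤ᵇ-cong {m} {n} to from with m ≤? n
... | yes m≤n = trans (𝟙-≤ᵇ-yes m≤n) (sym (𝟙-≤ᵇ-yes (to m≤n)))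
... | no  m≰n = trans (𝟙-≤ᵇ-no (≰⇒> m≰n)) (sym (𝟙-≤ᵇ-no (≰⇒> (m≰n ∘ from))))

𝟙-≤ᵇ-antitone : ∀ {m m′} n → m ≤ m′ → 𝟙 (m′ ≤ᵇ n) ≤ 𝟙 (m ≤ᵇ n)
𝟙-≤ᵇ-antitone {m} {m′} n m≤m′ with m′ ≤? n
... | yes m′≤n = ≤-reflexive (trans (𝟙-≤ᵇ-yes m′≤n) (sym (𝟙-≤ᵇ-yes (≤-trans m≤m′ m′≤n))))
... | no  m′≰n = subst (_≤ 𝟙 (m ≤ᵇ n)) (sym (𝟙-≤ᵇ-no (≰⇒> m′≰n))) z≤n

𝟙-≤ᵇ-shift : ∀ x {k d} → k ≤ d → 𝟙 (x + k ≤ᵇ d) ≡ 𝟙 (x ≤ᵇ d ∸ k)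
𝟙-≤ᵇ-shift x k≤d = 𝟙-≤ᵇ-cong (m+n≤o⇒m≤o∸n x) (m≤o∸n⇒m+n≤o x k≤d)

sum-map-filter : ∀ {A : Set} {P : A → Set} (P? : ∀ x → Dec (P x)) (g : A → ℕ) (xs : List A) →
  sum (map g (filter P? xs)) ≡ sum (map (λ x → if does (P? x) then g x else 0) xs)
sum-map-filter P? g []       = refl
sum-map-filter P? g (x ∷ xs) with does (P? x)
... | true  = cong (g x +_) (sum-map-filter P? g xs)
... | false = sum-map-filter P? g xs

σ-as-sum : ∀ {n} k (a : Vec ℕ n) → σ k a ≡ sum (map (λ S → if card S ≡ᵇ k then prodOn S a else 0) (allSubsets n))
σ-as-sum {n} k a = sum-map-filter (λ S → card S ≟ k) (λ S → prodOn S a) (allSubsets n)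

sum-allSubsets-suc : ∀ {n} (F : Vec Bool (suc n) → ℕ) →
  sum (map F (allSubsets (suc n))) ≡ sum (map (λ S → F (true ∷ S) + F (false ∷ S)) (allSubsets n))
sum-allSubsets-suc {n} F = go (allSubsets n)
  where
  go : (L : List (Vec Bool n)) →
    sum (map F (concatMap (λ S → (true ∷ S) ∷ (false ∷ S) ∷ []) L)) ≡ sum (map (λ S → F (true ∷ S) + F (false ∷ S)) L)
  go []      = refl
  go (S ∷ L) = trans (cong (λ z → F (true ∷ S) + (F (false ∷ S) + z)) (go L)) (sym (+-assoc (F (true ∷ S)) _ _))

σ-cons : ∀ {n} k x (b : Vec ℕ n) → σ (suc k) (x ∷ b) ≡ x * σ k b + σ (suc k) b
σ-cons {n} k x b = begin
  σ (suc k) (x ∷ b)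
    ≡⟨ σ-as-sum (suc k) (x ∷ b) ⟩
  sum (map (λ S → if card S ≡ᵇ suc k then prodOn S (x ∷ b) else 0) (allSubsets (suc n)))
    ≡⟨ sum-allSubsets-suc (λ S → if card S ≡ᵇ suc k then prodOn S (x ∷ b) else 0) ⟩
  sum (map (λ S → with-x S + without-x S) (allSubsets n))
    ≡⟨ sum-map-+ (allSubsets n) with-x without-x ⟩
  sum (map with-x (allSubsets n)) + sum (map without-x (allSubsets n))
    ≡⟨ cong (_+ sum (map without-x (allSubsets n))) (trans (sum-map-cong (allSubsets n) factor-x) (sum-map-* (allSubsets n) x _)) ⟩
  x * sum (map (λ S → if card S ≡ᵇ k then prodOn S b else 0) (allSubsets n)) + sum (map without-x (allSubsets n))
    ≡⟨ sym (cong₂ (λ p q → x * p + q) (σ-as-sum k b) (σ-as-sum (suc k) b)) ⟩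
  x * σ k b + σ (suc k) b ∎
  where
  with-x without-x : Vec Bool n → ℕ
  with-x    S = if card S ≡ᵇ k then x * prodOn S b else 0
  without-x S = if card S ≡ᵇ suc k then prodOn S b else 0
  factor-x : ∀ S → with-x S ≡ x * (if card S ≡ᵇ k then prodOn S b else 0)
  factor-x S with card S ≡ᵇ k
  ... | true  = refl
  ... | false = sym (*-zeroʳ x)

σ-zero : ∀ {n} (b : Vec ℕ n) → σ 0 b ≡ 1
σ-zero []      = refl
σ-zero {suc n} (x ∷ b) = begin
  σ 0 (x ∷ b)                                                                ≡⟨ σ-as-sum 0 (x ∷ b) ⟩
  sum (map (λ S → if card S ≡ᵇ 0 then prodOn S (x ∷ b) else 0) (allSubsets (suc n))) ≡⟨ sum-allSubsets-suc (λ S → if card S ≡ᵇ 0 then prodOn S (x ∷ b) else 0) ⟩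
  sum (map (λ S → if card S ≡ᵇ 0 then prodOn S b else 0) (allSubsets n))     ≡⟨ sym (σ-as-sum 0 b) ⟩
  σ 0 b                                                                      ≡⟨ σ-zero b ⟩
  1 ∎

σ-vanish : ∀ {n} k (b : Vec ℕ n) → n < k → σ k b ≡ 0
σ-vanish (suc k) []      _         = refl
σ-vanish (suc k) (x ∷ b) (s≤s n<k) = begin
  σ (suc k) (x ∷ b)            ≡⟨ σ-cons k x b ⟩
  x * σ k b + σ (suc k) b      ≡⟨ cong₂ (λ p q → x * p + q) (σ-vanish k b n<k) (σ-vanish (suc k) b (m<n⇒m<1+n n<k)) ⟩
  x * 0 + 0                    ≡⟨ cong (_+ 0) (*-zeroʳ x) ⟩
  0 ∎

-- prodEval b W is ∏_{x ∈ b} (x + X) evaluated under the linear map Xʰ ↦ W h;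
-- by the expansion of the product it equals Σⱼ W j · σ_{n−j}(b) (prodEval-σ).

prodEval : List ℕ → (ℕ → ℕ) → ℕ
prodEval []      W = W 0
prodEval (x ∷ b) W = x * prodEval b W + prodEval b (W ∘ suc)

prodEval-cong : ∀ b {W W′ : ℕ → ℕ} → (∀ h → W h ≡ W′ h) → prodEval b W ≡ prodEval b W′
prodEval-cong []      eq = eq 0
prodEval-cong (x ∷ b) eq = cong₂ (λ p q → x * p + q) (prodEval-cong b eq) (prodEval-cong b (eq ∘ suc))

prodEval-∑< : ∀ b m (W : ℕ → ℕ → ℕ) → ∑< m (λ t → prodEval b (W t)) ≡ prodEval b (λ h → ∑< m (λ t → W t h))
prodEval-∑< []      m W = refl
prodEval-∑< (x ∷ b) m W = begin
  ∑< m (λ t → x * prodEval b (W t) + prodEval b (W t ∘ suc))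
    ≡⟨ ∑<-+ m (λ t → x * prodEval b (W t)) (λ t → prodEval b (W t ∘ suc)) ⟩
  ∑< m (λ t → x * prodEval b (W t)) + ∑< m (λ t → prodEval b (W t ∘ suc))
    ≡⟨ cong₂ _+_ (trans (∑<-* m x (λ t → prodEval b (W t))) (cong (x *_) (prodEval-∑< b m W)))
                 (prodEval-∑< b m (λ t → W t ∘ suc)) ⟩
  x * prodEval b (λ h → ∑< m (λ t → W t h)) + prodEval b (λ h → ∑< m (λ t → W t (suc h))) ∎

-- The top coefficient of ∏ (x + X) is 1, so prodEval dominates the top weight.
prodEval-≥ : ∀ b (W : ℕ → ℕ) → W (length b) ≤ prodEval b W
prodEval-≥ []      W = ≤-refl
prodEval-≥ (x ∷ b) W = ≤-trans (prodEval-≥ b (W ∘ suc)) (m≤n+m _ _)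

prodEval-σ-reversed : ∀ {n} (b : Vec ℕ n) (W : ℕ → ℕ) → prodEval (toList b) W ≡ ∑< (suc n) (λ k → W (n ∸ k) * σ k b)
prodEval-σ-reversed []              W = sym (trans (+-identityʳ _) (*-identityʳ (W 0)))
prodEval-σ-reversed {suc n} (x ∷ b) W = begin
  x * prodEval (toList b) W + prodEval (toList b) (W ∘ suc)
    ≡⟨ cong₂ (λ p q → x * p + q) (prodEval-σ-reversed b W) (prodEval-σ-reversed b (W ∘ suc)) ⟩
  x * S₀ + (W (suc n) * σ 0 b + ∑< n (λ k → W (suc (n ∸ suc k)) * σ (suc k) b))
    ≡⟨ cong₂ (λ p q → x * S₀ + (W (suc n) * p + q)) (trans (σ-zero b) (sym (σ-zero (x ∷ b)))) shift ⟩
  x * S₀ + (W (suc n) * σ 0 (x ∷ b) + S₁)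
    ≡⟨ +-Comm.x∙yz≈y∙xz (x * S₀) (W (suc n) * σ 0 (x ∷ b)) S₁ ⟩
  W (suc n) * σ 0 (x ∷ b) + (x * S₀ + S₁)
    ≡⟨ cong (W (suc n) * σ 0 (x ∷ b) +_) (sym recombine) ⟩
  W (suc n) * σ 0 (x ∷ b) + ∑< (suc n) (λ k → W (n ∸ k) * σ (suc k) (x ∷ b)) ∎
  where
  S₀ S₁ : ℕ
  S₀ = ∑< (suc n) (λ k → W (n ∸ k) * σ k b)
  S₁ = ∑< (suc n) (λ k → W (n ∸ k) * σ (suc k) b)
  distribute : ∀ w x s t → w * (x * s + t) ≡ x * (w * s) + w * t
  distribute = solve-∀
  -- the last term of S₁ involves σ_{n+1}(b) = 0
  shift : ∑< n (λ k → W (suc (n ∸ suc k)) * σ (suc k) b) ≡ S₁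
  shift = sym (begin
    S₁ ≡⟨ ∑<-last n (λ k → W (n ∸ k) * σ (suc k) b) ⟩
    ∑< n (λ k → W (n ∸ k) * σ (suc k) b) + W (n ∸ n) * σ (suc n) b
      ≡⟨ cong₂ _+_ (∑<-cong n (λ k k<n → cong (λ z → W z * σ (suc k) b) (+-∸-assoc 1 k<n)))
                   (trans (cong (W (n ∸ n) *_) (σ-vanish (suc n) b ≤-refl)) (*-zeroʳ (W (n ∸ n)))) ⟩
    ∑< n (λ k → W (suc (n ∸ suc k)) * σ (suc k) b) + 0 ≡⟨ +-identityʳ _ ⟩
    ∑< n (λ k → W (suc (n ∸ suc k)) * σ (suc k) b) ∎)
  recombine : ∑< (suc n) (λ k → W (n ∸ k) * σ (suc k) (x ∷ b)) ≡ x * S₀ + S₁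
  recombine = begin
    ∑< (suc n) (λ k → W (n ∸ k) * σ (suc k) (x ∷ b))
      ≡⟨ ∑<-cong (suc n) (λ k _ → trans (cong (W (n ∸ k) *_) (σ-cons k x b)) (distribute (W (n ∸ k)) x (σ k b) (σ (suc k) b))) ⟩
    ∑< (suc n) (λ k → x * (W (n ∸ k) * σ k b) + W (n ∸ k) * σ (suc k) b)
      ≡⟨ ∑<-+ (suc n) (λ k → x * (W (n ∸ k) * σ k b)) (λ k → W (n ∸ k) * σ (suc k) b) ⟩
    ∑< (suc n) (λ k → x * (W (n ∸ k) * σ k b)) + S₁
      ≡⟨ cong (_+ S₁) (∑<-* (suc n) x (λ k → W (n ∸ k) * σ k b)) ⟩
    x * S₀ + S₁ ∎

prodEval-σ : ∀ {n} (b : Vec ℕ n) (W : ℕ → ℕ) → prodEval (toList b) W ≡ ∑< (suc n) (λ j → W j * σ (n ∸ j) b)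
prodEval-σ {n} b W = begin
  prodEval (toList b) W                              ≡⟨ prodEval-σ-reversed b W ⟩
  ∑< (suc n) (λ k → W (n ∸ k) * σ k b)               ≡⟨ ∑<-reverse (suc n) (λ k → W (n ∸ k) * σ k b) ⟩
  ∑< (suc n) (λ j → W (n ∸ (n ∸ j)) * σ (n ∸ j) b)
    ≡⟨ ∑<-cong (suc n) (λ j j<1+n → cong (λ z → W z * σ (n ∸ j) b) (m∸[m∸n]≡n (s≤s⁻¹ j<1+n))) ⟩
  ∑< (suc n) (λ j → W j * σ (n ∸ j) b) ∎

-- tupleSum M h f = Σ f(t₁ + ⋯ + tₕ) over all tuples (t₁,…,tₕ) ∈ {0,…,M}ʰ.

tupleSum : ℕ → ℕ → (ℕ → ℕ) → ℕ
tupleSum M zero    f = f 0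
tupleSum M (suc h) f = ∑< (suc M) (λ t → tupleSum M h (λ e → f (t + e)))

tupleSum-cong : ∀ M h {f g : ℕ → ℕ} → (∀ e → f e ≡ g e) → tupleSum M h f ≡ tupleSum M h g
tupleSum-cong M zero    eq = eq 0
tupleSum-cong M (suc h) eq = ∑<-cong (suc M) (λ t _ → tupleSum-cong M h (λ e → eq (t + e)))

tupleSum-zero : ∀ M h {f : ℕ → ℕ} → (∀ e → f e ≡ 0) → tupleSum M h f ≡ 0
tupleSum-zero M zero    eq = eq 0
tupleSum-zero M (suc h) eq = ∑<-zero (suc M) (λ t _ → tupleSum-zero M h (λ e → eq (t + e)))

tupleSum-+ : ∀ M h (f g : ℕ → ℕ) → tupleSum M h (λ e → f e + g e) ≡ tupleSum M h f + tupleSum M h g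
tupleSum-+ M zero    f g = refl
tupleSum-+ M (suc h) f g = trans (∑<-cong (suc M) (λ t _ → tupleSum-+ M h (λ e → f (t + e)) (λ e → g (t + e))))
  (∑<-+ (suc M) (λ t → tupleSum M h (λ e → f (t + e))) (λ t → tupleSum M h (λ e → g (t + e))))

tupleSum-∸ : ∀ M h (f g : ℕ → ℕ) → (∀ e → g e ≤ f e) → tupleSum M h (λ e → f e ∸ g e) ≡ tupleSum M h f ∸ tupleSum M h g
tupleSum-∸ M h f g g≤f = begin
  tupleSum M h (λ e → f e ∸ g e)                                     ≡⟨ sym (m+n∸n≡m _ (tupleSum M h g)) ⟩
  tupleSum M h (λ e → f e ∸ g e) + tupleSum M h g ∸ tupleSum M h g   ≡⟨ cong (_∸ tupleSum M h g) (sym (tupleSum-+ M h _ g)) ⟩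
  tupleSum M h (λ e → f e ∸ g e + g e) ∸ tupleSum M h g              ≡⟨ cong (_∸ tupleSum M h g) (tupleSum-cong M h (λ e → m∸n+n≡m (g≤f e))) ⟩
  tupleSum M h f ∸ tupleSum M h g                                    ∎

hockey-stick : ∀ L h → ∑< (suc L) (λ t → (L ∸ t + h) C h) ≡ (L + suc h) C suc h
hockey-stick zero    h = trans (+-identityʳ _) (trans (nCn≡1 h) (sym (nCn≡1 (suc h))))
hockey-stick (suc L) h = begin
  (suc L + h) C h + ∑< (suc L) (λ t → (L ∸ t + h) C h)   ≡⟨ cong₂ _+_ (cong (_C h) (sym (+-suc L h))) (hockey-stick L h) ⟩
  (L + suc h) C h + (L + suc h) C suc h                 ≡⟨ nCk+nC[k+1]≡[n+1]C[k+1] (L + suc h) h ⟩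
  suc (L + suc h) C suc h                               ∎

tupleSum-≤ : ∀ M h L → L ≤ M → tupleSum M h (λ e → 𝟙 (e ≤ᵇ L)) ≡ (L + h) C h
tupleSum-≤ M zero    L _   = refl
tupleSum-≤ M (suc h) L L≤M = begin
  ∑< (suc M) (λ t → count t)
    ≡⟨ cong (λ k → ∑< k count) (sym (cong suc (m+[n∸m]≡n L≤M))) ⟩
  ∑< (suc L + (M ∸ L)) count
    ≡⟨ ∑<-split (suc L) (M ∸ L) count ⟩
  ∑< (suc L) count + ∑< (M ∸ L) (λ t → count (suc L + t))
    ≡⟨ cong₂ _+_ (∑<-cong (suc L) low) (∑<-zero (M ∸ L) (λ t _ → tupleSum-zero M h (λ e → 𝟙-≤ᵇ-no (too-big t e)))) ⟩
  ∑< (suc L) (λ t → (L ∸ t + h) C h) + 0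
    ≡⟨ trans (+-identityʳ _) (hockey-stick L h) ⟩
  (L + suc h) C suc h ∎
  where
  count : ℕ → ℕ
  count t = tupleSum M h (λ e → 𝟙 (t + e ≤ᵇ L))
  too-big : ∀ t e → L < suc L + t + e
  too-big t e = s≤s (≤-trans (m≤m+n L t) (m≤m+n (L + t) e))
  low : ∀ t → t < suc L → count t ≡ (L ∸ t + h) C h
  low t (s≤s t≤L) = begin
    count t                                   ≡⟨ tupleSum-cong M h (λ e → 𝟙-≤ᵇ-cong (move e) (back e)) ⟩
    tupleSum M h (λ e → 𝟙 (e ≤ᵇ L ∸ t))       ≡⟨ tupleSum-≤ M h (L ∸ t) (≤-trans (m∸n≤m L t) L≤M) ⟩
    (L ∸ t + h) C h                           ∎
    where
    move : ∀ e → t + e ≤ L → e ≤ L ∸ t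
    move e le = subst (_≤ L ∸ t) (m+n∸m≡n t e) (∸-monoˡ-≤ t le)
    back : ∀ e → e ≤ L ∸ t → t + e ≤ L
    back e le = subst (t + e ≤_) (m+[n∸m]≡n t≤L) (+-monoʳ-≤ t le)

box : ∀ {n} → Vec ℕ n → List (Vec ℕ n)
box []       = [] ∷ []
box (B ∷ Bs) = cartesianProductWith _∷_ (upTo (suc B)) (box Bs)

box-complete : ∀ {n} (B c : Vec ℕ n) → c ≺ B → c ∈ box B
box-complete []       []       []         = here refl
box-complete (B ∷ Bs) (c ∷ cs) (c≤B ∷ le) = ∈-cartesianProductWith⁺ _∷_ (∈-upTo⁺ (s≤s c≤B)) (box-complete Bs cs le)

box-unique : ∀ {n} (B : Vec ℕ n) → Unique (box B)
box-unique []       = [] ∷ []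
box-unique (B ∷ Bs) = cartesianProductWith⁺ _∷_ ∷-injective (upTo⁺ (suc B)) (box-unique Bs)

sum-box : ∀ {n} B (Bs : Vec ℕ n) (F : Vec ℕ (suc n) → ℕ) →
  sum (map F (box (B ∷ Bs))) ≡ ∑< (suc B) (λ c₀ → sum (map (λ c → F (c₀ ∷ c)) (box Bs)))
sum-box B Bs F = trans (sum-map-cartesianProductWith _∷_ (upTo (suc B)) (box Bs) F) (sum-map-upTo (suc B) _)

reach : ∀ {n} → Vec ℕ n → Vec ℕ n → ℕ
reach []       []       = 0
reach (b ∷ bs) (c ∷ cs) = 𝟙 (b ≤ᵇ c) + reach bs cs

overflow : ∀ {n} → Vec ℕ n → Vec ℕ n → ℕ
overflow []       []       = 0
overflow (b ∷ bs) (c ∷ cs) = (c ∸ b) + overflow bs cs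

-- If B ≥ b + M and φ h e vanishes for e > M, then summing
-- φ(reach b c, overflow b c) over the box of B factorises over the coordinates:
-- a coordinate below bₖ contributes the factor bₖ, one equal to bₖ + t (t ≤ M)
-- contributes X with overflow t, so the total is prodEval b at the tuple sums.
sum-box-statistics : ∀ {n} M (B b : Vec ℕ n) (φ : ℕ → ℕ → ℕ) →
  Pointwise (λ x y → x + M ≤ y) b B → (∀ h e → M < e → φ h e ≡ 0) →
  sum (map (λ c → φ (reach b c) (overflow b c)) (box B)) ≡ prodEval (toList b) (λ h → tupleSum M h (φ h))
sum-box-statistics M []       []       φ []           vanish = +-identityʳ _
sum-box-statistics M (B ∷ Bs) (b ∷ bs) φ (b+M≤B ∷ le) vanish = begin
  sum (map (λ c → φ (reach (b ∷ bs) c) (overflow (b ∷ bs) c)) (box (B ∷ Bs)))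
    ≡⟨ sum-box B Bs _ ⟩
  ∑< (suc B) slice
    ≡⟨ cong (λ k → ∑< k slice) (sym split-point) ⟩
  ∑< (b + (suc M + (B ∸ (b + M)))) slice
    ≡⟨ ∑<-split b _ slice ⟩
  ∑< b slice + ∑< (suc M + (B ∸ (b + M))) (λ t → slice (b + t))
    ≡⟨ cong (∑< b slice +_) (∑<-split (suc M) (B ∸ (b + M)) (λ t → slice (b + t))) ⟩
  ∑< b slice + (∑< (suc M) (λ t → slice (b + t)) + ∑< (B ∸ (b + M)) (λ t → slice (b + (suc M + t))))
    ≡⟨ cong₂ (λ p q → p + (q + ∑< (B ∸ (b + M)) (λ t → slice (b + (suc M + t))))) below within ⟩
  b * prodEval (toList bs) W + (prodEval (toList bs) (W ∘ suc) + ∑< (B ∸ (b + M)) (λ t → slice (b + (suc M + t))))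
    ≡⟨ cong (λ z → b * prodEval (toList bs) W + z) (trans (cong (prodEval (toList bs) (W ∘ suc) +_) above) (+-identityʳ _)) ⟩
  b * prodEval (toList bs) W + prodEval (toList bs) (W ∘ suc) ∎
  where
  W : ℕ → ℕ
  W h = tupleSum M h (φ h)
  slice : ℕ → ℕ
  slice c₀ = sum (map (λ c → φ (𝟙 (b ≤ᵇ c₀) + reach bs c) ((c₀ ∸ b) + overflow bs c)) (box Bs))
  split-point : b + (suc M + (B ∸ (b + M))) ≡ suc B
  split-point = trans (sym (+-assoc b (suc M) _)) (trans (cong (_+ (B ∸ (b + M))) (+-suc b M)) (cong suc (m+[n∸m]≡n b+M≤B)))
  -- c₀ < b: the coordinate is neither reached nor overflowing
  below : ∑< b slice ≡ b * prodEval (toList bs) W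
  below = trans (∑<-cong b (λ c₀ c₀<b → trans
            (sum-map-cong (box Bs) (λ c → cong₂ (λ p q → φ (p + reach bs c) (q + overflow bs c)) (𝟙-≤ᵇ-no c₀<b) (m≤n⇒m∸n≡0 (<⇒≤ c₀<b))))
            (sum-box-statistics M Bs bs φ le vanish)))
          (∑<-const b _)
  -- c₀ = b + t with t ≤ M: the coordinate is reached and overflows by t
  within : ∑< (suc M) (λ t → slice (b + t)) ≡ prodEval (toList bs) (W ∘ suc)
  within = trans (∑<-cong (suc M) (λ t _ → trans
             (sum-map-cong (box Bs) (λ c → cong₂ (λ p q → φ (p + reach bs c) (q + overflow bs c)) (𝟙-≤ᵇ-yes (m≤m+n b t)) (m+n∸m≡n b t)))
             (sum-box-statistics M Bs bs (λ h e → φ (suc h) (t + e)) le (λ h e M<e → vanish (suc h) (t + e) (≤-trans M<e (m≤n+m e t))))))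
           (prodEval-∑< (toList bs) (suc M) (λ t h → tupleSum M h (λ e → φ (suc h) (t + e))))
  -- c₀ > b + M: the overflow exceeds M
  above : ∑< (B ∸ (b + M)) (λ t → slice (b + (suc M + t))) ≡ 0
  above = ∑<-zero (B ∸ (b + M)) (λ t _ → sum-map-zero (box Bs) (λ c → vanish _ _
            (subst (λ z → M < z + overflow bs c) (sym (m+n∸m≡n b (suc M + t)))
              (≤-trans (s≤s (m≤m+n M t)) (m≤m+n (suc M + t) (overflow bs c))))))

∸-step : ∀ x c → c ∸ x ≡ (c ∸ suc x) + 𝟙 (suc x ≤ᵇ c)
∸-step x c with suc x ≤? c
... | yes x<c = trans (+-∸-assoc 1 x<c) (trans (+-comm 1 _) (cong ((c ∸ suc x) +_) (sym (𝟙-≤ᵇ-yes x<c))))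
... | no  x≮c = begin
  c ∸ x                          ≡⟨ m≤n⇒m∸n≡0 (s≤s⁻¹ (≰⇒> x≮c)) ⟩
  0                              ≡⟨ sym (cong₂ _+_ (m≤n⇒m∸n≡0 (m≤n⇒m≤1+n (s≤s⁻¹ (≰⇒> x≮c)))) (𝟙-≤ᵇ-no (≰⇒> x≮c))) ⟩
  (c ∸ suc x) + 𝟙 (suc x ≤ᵇ c)   ∎

overflow-step : ∀ {n} i (a c : Vec ℕ n) → overflow (a +𝟏 i) c ≡ overflow (a +𝟏 suc i) c + reach (a +𝟏 suc i) c
overflow-step i []      []       = refl
overflow-step i (x ∷ a) (c ∷ cs) = trans (cong₂ _+_ (∸-step (i + x) c) (overflow-step i a cs)) (+-Comm.interchange (c ∸ suc (i + x)) _ _ _)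

reach-step : ∀ {n} i (a c : Vec ℕ n) → reach (a +𝟏 suc i) c ≤ reach (a +𝟏 i) c
reach-step i []      []       = z≤n
reach-step i (x ∷ a) (c ∷ cs) = +-mono-≤ (𝟙-≤ᵇ-antitone c (n≤1+n (i + x))) (reach-step i a cs)

anyBelow : ℕ → (ℕ → Bool) → Bool
anyBelow zero    A = false
anyBelow (suc k) A = anyBelow k A ∨ A k

anyBelow-elim : ∀ k (A : ℕ → Bool) → T (anyBelow k A) → Σ ℕ λ i → i < k × T (A i)
anyBelow-elim (suc k) A t with Equivalence.to T-∨ t
... | inj₁ t′ = let (i , i<k , Ai) = anyBelow-elim k A t′ in i , m<n⇒m<1+n i<k , Ai
... | inj₂ Ak = k , ≤-refl , Ak

anyBelow-intro : ∀ k (A : ℕ → Bool) i → i < k → T (A i) → T (anyBelow k A)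
anyBelow-intro (suc k) A i i<1+k Ai with m<1+n⇒m<n∨m≡n i<1+k
... | inj₁ i<k  = Equivalence.from T-∨ (inj₁ (anyBelow-intro k A i i<k Ai))
... | inj₂ refl = Equivalence.from T-∨ (inj₂ Ai)

𝟙-∨ : ∀ X Y Z → (T X → T Y → T Z) → (T Z → T X) → 𝟙 (X ∨ Y) ≡ 𝟙 X + 𝟙 Y * 𝟙 (not Z)
𝟙-∨ true  true  true  _    _    = refl
𝟙-∨ true  true  false X→Z  _    = ⊥-elim (X→Z tt tt)
𝟙-∨ true  false Z     _    _    = refl
𝟙-∨ false Y     true  _    Z→X  = ⊥-elim (Z→X tt)
𝟙-∨ false Y     false _    _    = sym (*-identityʳ (𝟙 Y))

-- If the layers passing A form an interval, then A holds somewhere in 0‥I iff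
-- it holds at 0 or the interval starts at some i + 1 ≤ I; these events are disjoint.
anyBelow-interval : ∀ (A : ℕ → Bool) → (∀ j k → j ≤ k → T (A j) → T (A (suc k)) → T (A k)) → ∀ I →
  𝟙 (anyBelow (suc I) A) ≡ 𝟙 (A 0) + ∑< I (λ i → 𝟙 (A (suc i)) * 𝟙 (not (A i)))
anyBelow-interval A interval zero    = sym (+-identityʳ _)
anyBelow-interval A interval (suc I) = begin
  𝟙 (anyBelow (suc I) A ∨ A (suc I))
    ≡⟨ 𝟙-∨ (anyBelow (suc I) A) (A (suc I)) (A I) filled (anyBelow-intro (suc I) A I ≤-refl) ⟩
  𝟙 (anyBelow (suc I) A) + start I
    ≡⟨ cong (_+ start I) (anyBelow-interval A interval I) ⟩
  𝟙 (A 0) + ∑< I start + start I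
    ≡⟨ trans (+-assoc (𝟙 (A 0)) _ _) (cong (𝟙 (A 0) +_) (sym (∑<-last I start))) ⟩
  𝟙 (A 0) + ∑< (suc I) start ∎
  where
  start : ℕ → ℕ
  start i = 𝟙 (A (suc i)) * 𝟙 (not (A i))
  filled : T (anyBelow (suc I) A) → T (A (suc I)) → T (A I)
  filled t A[1+I] = let (j , j<1+I , Aj) = anyBelow-elim (suc I) A t in interval j I (s≤s⁻¹ j<1+I) Aj A[1+I]

𝟙-and-not : ∀ Y Z → (T Z → T Y) → 𝟙 Y * 𝟙 (not Z) ≡ 𝟙 Y ∸ 𝟙 Z
𝟙-and-not true  true  _   = refl
𝟙-and-not true  false _   = refl
𝟙-and-not false false _   = refl
𝟙-and-not false true  Z→Y = ⊥-elim (Z→Y tt)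

𝟙-and-not-vanish : ∀ Y Z → (T Y → T Z) → 𝟙 Y * 𝟙 (not Z) ≡ 0
𝟙-and-not-vanish true  true  _   = refl
𝟙-and-not-vanish true  false Y→Z = ⊥-elim (Y→Z tt)
𝟙-and-not-vanish false Z     _   = refl

-- The test for "the first good layer is the current one", in terms of the current
-- layer's statistics: h coordinates reached, overflow e, remaining budget E.
entryTest : (u E h e : ℕ) → ℕ
entryTest u E h e = 𝟙 (u <ᵇ h) * (𝟙 (e ≤ᵇ E) ∸ 𝟙 (e + (h ∸ u) ≤ᵇ E))

-- The layer functional g i = e i + u·i, where going from layer i to i + 1 trades
-- h (i + 1) units of e for u more units of u·i.  As h is non-increasing, g is
-- convex, so its sublevel sets are intervals, and the start of a sublevel
-- interval at i + 1 is detected by entryTest on layer i + 1.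
module Convex (u d : ℕ) (e h : ℕ → ℕ)
              (e-step : ∀ i → e i ≡ e (suc i) + h (suc i)) (h-anti : ∀ i → h (suc i) ≤ h i) where

  g : ℕ → ℕ
  g i = e i + u * i

  g-step : ∀ i → g i + u ≡ g (suc i) + h (suc i)
  g-step i = begin
    e i + u * i + u                      ≡⟨ cong (λ z → z + u * i + u) (e-step i) ⟩
    e (suc i) + h (suc i) + u * i + u    ≡⟨ rearrange (e (suc i)) (h (suc i)) u i ⟩
    e (suc i) + u * suc i + h (suc i)    ∎
    where
    rearrange : ∀ a b u i → a + b + u * i + u ≡ a + u * suc i + b
    rearrange = solve-∀

  g-down : ∀ i → u ≤ h (suc i) → g (suc i) ≤ g i
  g-down i u≤h = +-cancelʳ-≤ (h (suc i)) _ _ (subst (_≤ g i + h (suc i)) (g-step i) (+-monoʳ-≤ (g i) u≤h))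

  g-up : ∀ i → h (suc i) ≤ u → g i ≤ g (suc i)
  g-up i h≤u = +-cancelʳ-≤ u _ _ (subst (λ z → z ≤ g (suc i) + u) (sym (g-step i)) (+-monoʳ-≤ (g (suc i)) h≤u))

  g-down-from : ∀ j m → u ≤ h (j + m) → g (j + m) ≤ g j
  g-down-from j zero    _   = ≤-reflexive (cong g (+-identityʳ j))
  g-down-from j (suc m) u≤h =
    subst (λ z → g z ≤ g j) (sym (+-suc j m))
      (≤-trans (g-down (j + m) u≤h′) (g-down-from j m (≤-trans u≤h′ (h-anti (j + m)))))
    where
    u≤h′ : u ≤ h (suc (j + m))
    u≤h′ = subst (λ z → u ≤ h z) (+-suc j m) u≤h

  sublevel-interval : ∀ j k → j ≤ k → g j ≤ d → g (suc k) ≤ d → g k ≤ d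
  sublevel-interval j k j≤k gj≤d gk′≤d with ≤-total u (h (suc k))
  ... | inj₁ u≤h = ≤-trans (subst (λ z → g z ≤ g j) (m+[n∸m]≡n j≤k) (g-down-from j (k ∸ j) u≤hk)) gj≤d
    where
    u≤hk : u ≤ h (j + (k ∸ j))
    u≤hk = subst (λ z → u ≤ h z) (sym (m+[n∸m]≡n j≤k)) (≤-trans u≤h (h-anti k))
  ... | inj₂ h≤u = ≤-trans (g-up k h≤u) gk′≤d

  g-via-next : ∀ i → u ≤ h (suc i) → g i ≡ e (suc i) + (h (suc i) ∸ u) + u * suc i
  g-via-next i u≤h = begin
    e i + u * i                                   ≡⟨ cong (_+ u * i) (e-step i) ⟩
    e (suc i) + h (suc i) + u * i                 ≡⟨ cong (λ z → e (suc i) + z + u * i) (sym (m∸n+n≡m u≤h)) ⟩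
    e (suc i) + ((h (suc i) ∸ u) + u) + u * i     ≡⟨ rearrange (e (suc i)) (h (suc i) ∸ u) u i ⟩
    e (suc i) + (h (suc i) ∸ u) + u * suc i       ∎
    where
    rearrange : ∀ a k u i → a + (k + u) + u * i ≡ a + k + u * suc i
    rearrange = solve-∀

  A : ℕ → Bool
  A i = g i ≤ᵇ d

  A-interval : ∀ j k → j ≤ k → T (A j) → T (A (suc k)) → T (A k)
  A-interval j k j≤k Aj Ak′ = ≤⇒≤ᵇ (sublevel-interval j k j≤k (≤ᵇ⇒≤ (g j) d Aj) (≤ᵇ⇒≤ (g (suc k)) d Ak′))

  -- A good interval starting at i + 1 forces h (i + 1) > u, and is then detected
  -- by the entry test of layer i + 1 alone.
  rise : ∀ i → u * suc i ≤ d → 𝟙 (A (suc i)) * 𝟙 (not (A i)) ≡ entryTest u (d ∸ u * suc i) (h (suc i)) (e (suc i))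
  rise i room with u <? h (suc i)
  ... | yes u<h = begin
    𝟙 (A (suc i)) * 𝟙 (not (A i))
      ≡⟨ 𝟙-and-not (A (suc i)) (A i) (λ Ai → ≤⇒≤ᵇ (≤-trans (g-down i (<⇒≤ u<h)) (≤ᵇ⇒≤ (g i) d Ai))) ⟩
    𝟙 (A (suc i)) ∸ 𝟙 (g i ≤ᵇ d)
      ≡⟨ cong (λ z → 𝟙 (A (suc i)) ∸ 𝟙 (z ≤ᵇ d)) (g-via-next i (<⇒≤ u<h)) ⟩
    𝟙 (e (suc i) + u * suc i ≤ᵇ d) ∸ 𝟙 (e (suc i) + (h (suc i) ∸ u) + u * suc i ≤ᵇ d)
      ≡⟨ cong₂ _∸_ (𝟙-≤ᵇ-shift (e (suc i)) room) (𝟙-≤ᵇ-shift (e (suc i) + (h (suc i) ∸ u)) room) ⟩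
    𝟙 (e (suc i) ≤ᵇ E) ∸ 𝟙 (e (suc i) + (h (suc i) ∸ u) ≤ᵇ E)
      ≡⟨ sym (+-identityʳ _) ⟩
    1 * (𝟙 (e (suc i) ≤ᵇ E) ∸ 𝟙 (e (suc i) + (h (suc i) ∸ u) ≤ᵇ E))
      ≡⟨ cong (λ z → z * (𝟙 (e (suc i) ≤ᵇ E) ∸ 𝟙 (e (suc i) + (h (suc i) ∸ u) ≤ᵇ E))) (sym (𝟙-true (<⇒<ᵇ u<h))) ⟩
    entryTest u E (h (suc i)) (e (suc i)) ∎
    where
    E = d ∸ u * suc i
  ... | no u≮h = begin
    𝟙 (A (suc i)) * 𝟙 (not (A i))
      ≡⟨ 𝟙-and-not-vanish (A (suc i)) (A i) (λ Ai′ → ≤⇒≤ᵇ (≤-trans (g-up i (≮⇒≥ u≮h)) (≤ᵇ⇒≤ (g (suc i)) d Ai′))) ⟩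
    0
      ≡⟨ cong (_* (𝟙 (e (suc i) ≤ᵇ E) ∸ 𝟙 (e (suc i) + (h (suc i) ∸ u) ≤ᵇ E))) (sym (𝟙-false (u≮h ∘ <ᵇ⇒< u (h (suc i))))) ⟩
    entryTest u E (h (suc i)) (e (suc i)) ∎
    where
    E = d ∸ u * suc i

-- Layer i of the decomposition of K, as a test on (reach, overflow) relative to
-- a + i𝟏, and the corresponding weight after summing over tuples.

layerTest : (u d i h e : ℕ) → ℕ
layerTest u d zero    h e = 𝟙 (e ≤ᵇ d)
layerTest u d (suc i) h e = entryTest u (d ∸ u * suc i) h e

layerWeight : (u d i h : ℕ) → ℕ
layerWeight u d zero    h = (d + h) C h
layerWeight u d (suc i) h = 𝟙 (u <ᵇ h) * (((d ∸ u * suc i) + h) C h ∸ ((d ∸ u * suc i) + u) C h)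

inK? : ∀ {n} (u d I : ℕ) → Vec ℕ n → Vec ℕ n → Bool
inK? u d I a c = anyBelow (suc I) (λ i → overflow (a +𝟏 i) c + u * i ≤ᵇ d)

-- The indicator of inK? is the sum of the layer tests (exactly one layer is the first good one).
𝟙-inK? : ∀ {n} u d I (a c : Vec ℕ n) → u * I ≤ d →
  𝟙 (inK? u d I a c) ≡ ∑< (suc I) (λ i → layerTest u d i (reach (a +𝟏 i) c) (overflow (a +𝟏 i) c))
𝟙-inK? u d I a c uI≤d =
  trans (anyBelow-interval A A-interval I)
        (cong₂ _+_ (cong (λ z → 𝟙 (z ≤ᵇ d)) (trans (cong (overflow (a +𝟏 0) c +_) (*-zeroʳ u)) (+-identityʳ _)))
                   (∑<-cong I (λ i i<I → rise i (≤-trans (*-monoʳ-≤ u i<I) uI≤d))))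
  where open Convex u d (λ i → overflow (a +𝟏 i) c) (λ i → reach (a +𝟏 i) c) (λ i → overflow-step i a c) (λ i → reach-step i a c)

layerTest-vanish : ∀ u d i h e → d ∸ u * i < e → layerTest u d i h e ≡ 0
layerTest-vanish u d zero    h e d<e = 𝟙-≤ᵇ-no (subst (_< e) (cong (d ∸_) (*-zeroʳ u)) d<e)
layerTest-vanish u d (suc i) h e E<e = begin
  𝟙 (u <ᵇ h) * (𝟙 (e ≤ᵇ E) ∸ 𝟙 (e + (h ∸ u) ≤ᵇ E)) ≡⟨ cong (λ z → 𝟙 (u <ᵇ h) * (z ∸ 𝟙 (e + (h ∸ u) ≤ᵇ E))) (𝟙-≤ᵇ-no E<e) ⟩
  𝟙 (u <ᵇ h) * (0 ∸ 𝟙 (e + (h ∸ u) ≤ᵇ E))         ≡⟨ cong (𝟙 (u <ᵇ h) *_) (0∸n≡0 (𝟙 (e + (h ∸ u) ≤ᵇ E))) ⟩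
  𝟙 (u <ᵇ h) * 0                                  ≡⟨ *-zeroʳ (𝟙 (u <ᵇ h)) ⟩
  0                                               ∎
  where
  E = d ∸ u * suc i

tupleSum-entryTest : ∀ u E h → tupleSum E h (entryTest u E h) ≡ 𝟙 (u <ᵇ h) * ((E + h) C h ∸ (E + u) C h)
tupleSum-entryTest u E h with u <? h
... | no  u≮h = trans (tupleSum-zero E h (λ e → cong (_* (𝟙 (e ≤ᵇ E) ∸ 𝟙 (e + (h ∸ u) ≤ᵇ E))) no-entry))
                      (cong (_* ((E + h) C h ∸ (E + u) C h)) (sym no-entry))
  where
  no-entry : 𝟙 (u <ᵇ h) ≡ 0
  no-entry = 𝟙-false (u≮h ∘ <ᵇ⇒< u h)
... | yes u<h = begin
  tupleSum E h (entryTest u E h)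
    ≡⟨ tupleSum-cong E h (λ e → trans (cong (_* (𝟙 (e ≤ᵇ E) ∸ 𝟙 (e + k ≤ᵇ E))) entry) (+-identityʳ _)) ⟩
  tupleSum E h (λ e → 𝟙 (e ≤ᵇ E) ∸ 𝟙 (e + k ≤ᵇ E))
    ≡⟨ tupleSum-∸ E h (λ e → 𝟙 (e ≤ᵇ E)) (λ e → 𝟙 (e + k ≤ᵇ E)) (λ e → 𝟙-≤ᵇ-antitone E (m≤m+n e k)) ⟩
  tupleSum E h (λ e → 𝟙 (e ≤ᵇ E)) ∸ tupleSum E h (λ e → 𝟙 (e + k ≤ᵇ E))
    ≡⟨ cong₂ _∸_ (tupleSum-≤ E h E ≤-refl) shifted ⟩
  (E + h) C h ∸ (E + u) C h
    ≡⟨ sym (trans (cong (_* ((E + h) C h ∸ (E + u) C h)) entry) (+-identityʳ _)) ⟩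
  𝟙 (u <ᵇ h) * ((E + h) C h ∸ (E + u) C h) ∎
  where
  k = h ∸ u
  entry : 𝟙 (u <ᵇ h) ≡ 1
  entry = 𝟙-true (<⇒<ᵇ u<h)
  -- tuples with sum ≤ E − k, where E − k + h = E + u
  shifted : tupleSum E h (λ e → 𝟙 (e + k ≤ᵇ E)) ≡ (E + u) C h
  shifted with k ≤? E
  ... | yes k≤E = begin
    tupleSum E h (λ e → 𝟙 (e + k ≤ᵇ E))   ≡⟨ tupleSum-cong E h (λ e → 𝟙-≤ᵇ-shift e k≤E) ⟩
    tupleSum E h (λ e → 𝟙 (e ≤ᵇ E ∸ k))   ≡⟨ tupleSum-≤ E h (E ∸ k) (m∸n≤m E k) ⟩
    (E ∸ k + h) C h                       ≡⟨ cong (_C h) top ⟩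
    (E + u) C h                           ∎
    where
    top : E ∸ k + h ≡ E + u
    top = begin
      E ∸ k + h         ≡⟨ cong (E ∸ k +_) (sym (m∸n+n≡m (<⇒≤ u<h))) ⟩
      E ∸ k + (k + u)   ≡⟨ sym (+-assoc (E ∸ k) k u) ⟩
      E ∸ k + k + u     ≡⟨ cong (_+ u) (m∸n+n≡m k≤E) ⟩
      E + u             ∎
  ... | no  k≰E = trans (tupleSum-zero E h (λ e → 𝟙-≤ᵇ-no (≤-trans (≰⇒> k≰E) (m≤n+m k e))))
                        (sym (k>n⇒nCk≡0 (subst (E + u <_) (m∸n+n≡m (<⇒≤ u<h)) (+-monoˡ-< u (≰⇒> k≰E)))))

tupleSum-layerTest : ∀ u d i h → tupleSum (d ∸ u * i) h (layerTest u d i h) ≡ layerWeight u d i h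
tupleSum-layerTest u d zero    h = tupleSum-≤ (d ∸ u * 0) h d (≤-reflexive (cong (d ∸_) (sym (*-zeroʳ u))))
tupleSum-layerTest u d (suc i) h = tupleSum-entryTest u (d ∸ u * suc i) h

-- c ∈ D(U(b, E)) iff overflow b c ≤ E; for the converse the slack E − overflow
-- is put on the first coordinate, so n ≥ 1 is needed.

overflow-≤ : ∀ {n} (b ε c : Vec ℕ n) → c ≺ Vec.zipWith _+_ b ε → overflow b c ≤ ∣ ε ∣ᵥ
overflow-≤ []       []       []       []         = z≤n
overflow-≤ (b ∷ bs) (ε ∷ εs) (c ∷ cs) (c≤b+ε ∷ le) =
  +-mono-≤ (subst (c ∸ b ≤_) (m+n∸m≡n b ε) (∸-monoˡ-≤ b c≤b+ε)) (overflow-≤ bs εs cs le)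

gaps : ∀ {n} → Vec ℕ n → Vec ℕ n → Vec ℕ n
gaps []       []       = []
gaps (b ∷ bs) (c ∷ cs) = (c ∸ b) ∷ gaps bs cs

∣gaps∣ : ∀ {n} (b c : Vec ℕ n) → ∣ gaps b c ∣ᵥ ≡ overflow b c
∣gaps∣ []       []       = refl
∣gaps∣ (b ∷ bs) (c ∷ cs) = cong ((c ∸ b) +_) (∣gaps∣ bs cs)

gaps-cover : ∀ {n} (b c : Vec ℕ n) → c ≺ Vec.zipWith _+_ b (gaps b c)
gaps-cover []       []       = []
gaps-cover (b ∷ bs) (c ∷ cs) = m≤n+m∸n c b ∷ gaps-cover bs cs

overflow-witness : ∀ {n} (b c : Vec ℕ (suc n)) E → overflow b c ≤ E →
  Σ (Vec ℕ (suc n)) λ ε → ∣ ε ∣ᵥ ≡ E × c ≺ Vec.zipWith _+_ b ε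
overflow-witness (b ∷ bs) (c ∷ cs) E le =
  ((c ∸ b) + slack) ∷ gaps bs cs , total , ≤-trans (m≤n+m∸n c b) (+-monoʳ-≤ b (m≤m+n (c ∸ b) slack)) ∷ gaps-cover bs cs
  where
  slack = E ∸ overflow (b ∷ bs) (c ∷ cs)
  rearrange : ∀ a s o → a + s + o ≡ (a + o) + s
  rearrange = solve-∀
  total : (c ∸ b) + slack + ∣ gaps bs cs ∣ᵥ ≡ E
  total = begin
    (c ∸ b) + slack + ∣ gaps bs cs ∣ᵥ      ≡⟨ cong ((c ∸ b) + slack +_) (∣gaps∣ bs cs) ⟩
    (c ∸ b) + slack + overflow bs cs       ≡⟨ rearrange (c ∸ b) slack (overflow bs cs) ⟩
    overflow (b ∷ bs) (c ∷ cs) + slack     ≡⟨ m+[n∸m]≡n le ⟩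
    E                                      ∎

≺-box : ∀ {n} i E d (a ε c : Vec ℕ n) → c ≺ Vec.zipWith _+_ (a +𝟏 i) ε → ∣ ε ∣ᵥ ≤ E → i + E ≤ d → c ≺ (a +𝟏 d)
≺-box i E d []       []       []       []         _     _       = []
≺-box i E d (x ∷ a) (ε ∷ εs) (c ∷ cs) (c≤ ∷ le) ∣ε∣≤E i+E≤d =
  ≤-trans c≤ (≤-trans (+-monoʳ-≤ (i + x) (≤-trans (m≤m+n ε ∣ εs ∣ᵥ) ∣ε∣≤E)) (subst (_≤ d + x) (+-Comm.xy∙z≈xz∙y i E x) (+-monoˡ-≤ x i+E≤d)))
  ∷ ≺-box i E d a εs cs le (≤-trans (m≤n+m ∣ εs ∣ᵥ ε) ∣ε∣≤E) i+E≤d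

+𝟏-room : ∀ {n} (a : Vec ℕ n) i M d → i + M ≤ d → Pointwise (λ x y → x + M ≤ y) (a +𝟏 i) (a +𝟏 d)
+𝟏-room []      i M d _     = []
+𝟏-room (x ∷ a) i M d i+M≤d = subst (_≤ d + x) (+-Comm.xy∙z≈xz∙y i M x) (+-monoˡ-≤ x i+M≤d) ∷ +𝟏-room a i M d i+M≤d

length-filter : ∀ {A : Set} (p : A → Bool) (xs : List A) → length (filter (λ x → T? (p x)) xs) ≡ sum (map (λ x → 𝟙 (p x)) xs)
length-filter p []       = refl
length-filter p (x ∷ xs) with p x
... | true  = cong suc (length-filter p xs)
... | false = length-filter p xs

KHasSize-unique : ∀ {r n a d k m} → KHasSize r n a d k → KHasSize r n a d m → k ≡ m
KHasSize-unique (xs , xs-unique , xs-enum , refl) (ys , ys-unique , ys-enum , refl) =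
  ↭-length (∼bag⇒↭ (unique∧set⇒bag xs-unique ys-unique (λ {c} → mk⇔
    (Equivalence.from (ys-enum c) ∘ Equivalence.to (xs-enum c))
    (Equivalence.from (xs-enum c) ∘ Equivalence.to (ys-enum c)))))

G : ∀ {n} (u d I : ℕ) → Vec ℕ n → ℕ
G u d I v = ∑< (suc I) (λ i → prodEval (toList (v +𝟏 i)) (layerWeight u d i))

data Insert (y : ℕ) : List ℕ → List ℕ → Set where
  here  : ∀ {r} → Insert y r (y ∷ r)
  there : ∀ {z r L} → Insert y r L → Insert y (z ∷ r) (z ∷ L)

data Insert₂ (x y : ℕ) : List ℕ → List ℕ → Set where
  here-x : ∀ {r L} → Insert y r L → Insert₂ x y r (x ∷ L)
  here-y : ∀ {r L} → Insert x r L → Insert₂ x y r (y ∷ L)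
  there  : ∀ {z r L} → Insert₂ x y r L → Insert₂ x y (z ∷ r) (z ∷ L)

Insert-map : ∀ (f : ℕ → ℕ) {y r L} → Insert y r L → Insert (f y) (map f r) (map f L)
Insert-map f here       = here
Insert-map f (there ins) = there (Insert-map f ins)

Insert₂-map : ∀ (f : ℕ → ℕ) {x y r L} → Insert₂ x y r L → Insert₂ (f x) (f y) (map f r) (map f L)
Insert₂-map f (here-x ins) = here-x (Insert-map f ins)
Insert₂-map f (here-y ins) = here-y (Insert-map f ins)
Insert₂-map f (there ins)  = there (Insert₂-map f ins)

sum-Insert : ∀ {y r L} → Insert y r L → sum L ≡ y + sum r
sum-Insert here                    = refl
sum-Insert {y} (there {z} {r} ins) = trans (cong (z +_) (sum-Insert ins)) (+-Comm.x∙yz≈y∙xz z y (sum r))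

sum-Insert₂ : ∀ {x y r L} → Insert₂ x y r L → sum L ≡ x + y + sum r
sum-Insert₂ {x} {y} (here-x {r} ins) = trans (cong (x +_) (sum-Insert ins)) (sym (+-assoc x y (sum r)))
sum-Insert₂ {x} {y} (here-y {r} ins) = trans (cong (y +_) (sum-Insert ins)) (+-Comm.x∙yz≈yx∙z y x (sum r))
sum-Insert₂ {x} {y} (there {z} {r} ins) = trans (cong (z +_) (sum-Insert₂ ins)) (+-Comm.x∙yz≈y∙xz z (x + y) (sum r))

-- Inserting y multiplies ∏ (x + X) by (y + X).
prodEval-Insert : ∀ {y r L} → Insert y r L → (W : ℕ → ℕ) → prodEval L W ≡ y * prodEval r W + prodEval r (W ∘′ suc)
prodEval-Insert here                    W = refl
prodEval-Insert {y} (there {z} {r} ins) W =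
  trans (cong₂ (λ p q → z * p + q) (prodEval-Insert ins W) (prodEval-Insert ins (W ∘′ suc)))
        (commute z y (prodEval r W) (prodEval r (W ∘′ suc)) (prodEval r (W ∘′ suc ∘′ suc)))
  where
  commute : ∀ z y P Q R → z * (y * P + Q) + (y * Q + R) ≡ y * (z * P + Q) + (z * Q + R)
  commute = solve-∀

-- Inserting x and y multiplies ∏ (x + X) by (x + X)(y + X) = xy + (x + y)X + X².
prodEval-Insert₂ : ∀ {x y r L} → Insert₂ x y r L → (W : ℕ → ℕ) →
  prodEval L W ≡ x * y * prodEval r W + (x + y) * prodEval r (W ∘′ suc) + prodEval r (W ∘′ suc ∘′ suc)
prodEval-Insert₂ {x} {y} (here-x {r} ins) W =
  trans (cong₂ (λ p q → x * p + q) (prodEval-Insert ins W) (prodEval-Insert ins (W ∘′ suc)))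
        (expand x y (prodEval r W) (prodEval r (W ∘′ suc)) (prodEval r (W ∘′ suc ∘′ suc)))
  where
  expand : ∀ x y P Q R → x * (y * P + Q) + (y * Q + R) ≡ x * y * P + (x + y) * Q + R
  expand = solve-∀
prodEval-Insert₂ {x} {y} (here-y {r} ins) W =
  trans (cong₂ (λ p q → y * p + q) (prodEval-Insert ins W) (prodEval-Insert ins (W ∘′ suc)))
        (expand x y (prodEval r W) (prodEval r (W ∘′ suc)) (prodEval r (W ∘′ suc ∘′ suc)))
  where
  expand : ∀ x y P Q R → y * (x * P + Q) + (x * Q + R) ≡ x * y * P + (x + y) * Q + R
  expand = solve-∀
prodEval-Insert₂ {x} {y} (there {z} {r} ins) W =
  trans (cong₂ (λ p q → z * p + q) (prodEval-Insert₂ ins W) (prodEval-Insert₂ ins (W ∘′ suc)))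
        (expand z x y (prodEval r W) (prodEval r (W ∘′ suc)) (prodEval r (W ∘′ suc ∘′ suc)) (prodEval r (W ∘′ suc ∘′ suc ∘′ suc)))
  where
  expand : ∀ z x y P Q R S → z * (x * y * P + (x + y) * Q + R) + (x * y * Q + (x + y) * R + S)
                           ≡ x * y * (z * P + Q) + (x + y) * (z * Q + R) + (z * R + S)
  expand = solve-∀

prodEval-transfer-≤ : ∀ {x y x′ y′ r L L′} → Insert₂ x y r L → Insert₂ x′ y′ r L′ →
  x + y ≡ x′ + y′ → x * y ≤ x′ * y′ → (W : ℕ → ℕ) → prodEval L W ≤ prodEval L′ W
prodEval-transfer-≤ {x} {y} {x′} {y′} {r} ins ins′ same-sum more-product W =
  subst₂ _≤_ (sym (prodEval-Insert₂ ins W)) (sym (prodEval-Insert₂ ins′ W))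
    (+-monoˡ-≤ (prodEval r (W ∘′ suc ∘′ suc))
      (+-mono-≤ (*-monoˡ-≤ (prodEval r W) more-product) (≤-reflexive (cong (_* prodEval r (W ∘′ suc)) same-sum))))

prodEval-transfer-< : ∀ {x y x′ y′ r L L′} → Insert₂ x y r L → Insert₂ x′ y′ r L′ →
  x + y ≡ x′ + y′ → x * y < x′ * y′ → (W : ℕ → ℕ) → 0 < prodEval r W → prodEval L W < prodEval L′ W
prodEval-transfer-< {x} {y} {x′} {y′} {r} ins ins′ same-sum more-product W positive =
  subst₂ _<_ (sym (prodEval-Insert₂ ins W)) (sym (prodEval-Insert₂ ins′ W))
    (+-monoˡ-< (prodEval r (W ∘′ suc ∘′ suc))
      (+-mono-<-≤ (*-monoˡ-< (prodEval r W) {{>-nonZero positive}} more-product)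
                  (≤-reflexive (cong (_* prodEval r (W ∘′ suc)) same-sum))))

Insert-updateAt : ∀ {n} (v : Vec ℕ n) q (g : ℕ → ℕ) →
  Σ (List ℕ) λ r → Insert (lookup v q) r (toList v) × Insert (g (lookup v q)) r (toList (updateAt v q g))
Insert-updateAt (x ∷ v) zero    g = toList v , here , here
Insert-updateAt (x ∷ v) (suc q) g = let (r , ins , ins′) = Insert-updateAt v q g in x ∷ r , there ins , there ins′

Insert₂-updateAt : ∀ {n} (v : Vec ℕ n) p q (f g : ℕ → ℕ) → p ≢ q →
  Σ (List ℕ) λ r → Insert₂ (lookup v p) (lookup v q) r (toList v)
                 × Insert₂ (f (lookup v p)) (g (lookup v q)) r (toList (updateAt (updateAt v p f) q g))
Insert₂-updateAt (x ∷ v) zero    zero    f g p≢q = ⊥-elim (p≢q refl)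
Insert₂-updateAt (x ∷ v) zero    (suc q) f g _   = let (r , ins , ins′) = Insert-updateAt v q g in r , here-x ins , here-x ins′
Insert₂-updateAt (x ∷ v) (suc p) zero    f g _   = let (r , ins , ins′) = Insert-updateAt v p f in r , here-y ins , here-y ins′
Insert₂-updateAt (x ∷ v) (suc p) (suc q) f g p≢q =
  let (r , ins , ins′) = Insert₂-updateAt v p q f g (p≢q ∘ cong suc) in x ∷ r , there ins , there ins′

Transfer : ∀ {n} (x y x′ y′ : ℕ) → Vec ℕ n → Vec ℕ n → Set
Transfer x y x′ y′ v w = Σ (List ℕ) λ r → Insert₂ x y r (toList v) × Insert₂ x′ y′ r (toList w)

Transfer-shift : ∀ {n} {x y x′ y′} {v w : Vec ℕ n} i → Transfer x y x′ y′ v w →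
  Transfer (i + x) (i + y) (i + x′) (i + y′) (v +𝟏 i) (w +𝟏 i)
Transfer-shift {v = v} {w} i (r , ins , ins′) =
  map (i +_) r , subst (Insert₂ _ _ _) (sym (toList-map (i +_) v)) (Insert₂-map (i +_) ins)
               , subst (Insert₂ _ _ _) (sym (toList-map (i +_) w)) (Insert₂-map (i +_) ins′)

Transfer-sum : ∀ {n} {x y x′ y′} {v w : Vec ℕ n} → Transfer x y x′ y′ v w → x + y ≡ x′ + y′ → ∣ v ∣ᵥ ≡ ∣ w ∣ᵥ
Transfer-sum {x = x} {y} {x′} {y′} {v} {w} (r , ins , ins′) same-sum = begin
  ∣ v ∣ᵥ              ≡⟨ ∣∣ᵥ-toList v ⟩
  sum (toList v)      ≡⟨ sum-Insert₂ ins ⟩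
  x + y + sum r       ≡⟨ cong (_+ sum r) same-sum ⟩
  x′ + y′ + sum r     ≡⟨ sym (sum-Insert₂ ins′) ⟩
  sum (toList w)      ≡⟨ sym (∣∣ᵥ-toList w) ⟩
  ∣ w ∣ᵥ              ∎
  where
  ∣∣ᵥ-toList : ∀ {n} (v : Vec ℕ n) → ∣ v ∣ᵥ ≡ sum (toList v)
  ∣∣ᵥ-toList []      = refl
  ∣∣ᵥ-toList (x ∷ v) = cong (x +_) (∣∣ᵥ-toList v)

shift-sum : ∀ i {x y x′ y′} → x + y ≡ x′ + y′ → (i + x) + (i + y) ≡ (i + x′) + (i + y′)
shift-sum i {x} {y} {x′} {y′} same-sum = trans (regroup i x y) (trans (cong (i + i +_) same-sum) (sym (regroup i x′ y′)))
  where
  regroup : ∀ i x y → (i + x) + (i + y) ≡ i + i + (x + y)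
  regroup = solve-∀

shift-product : ∀ i {x y x′ y′} → x + y ≡ x′ + y′ → x * y ≤ x′ * y′ → (i + x) * (i + y) ≤ (i + x′) * (i + y′)
shift-product i {x} {y} {x′} {y′} same-sum more-product =
  subst₂ _≤_ (sym (expand i x y)) (sym (expand i x′ y′)) (+-mono-≤ (≤-reflexive (cong (λ s → i * i + i * s) same-sum)) more-product)
  where
  expand : ∀ i x y → (i + x) * (i + y) ≡ i * i + i * (x + y) + x * y
  expand = solve-∀

1≤C : ∀ m k → 1 ≤ (m + k) C k
1≤C m zero    = ≤-refl
1≤C m (suc k) = ≤-trans (1≤C m k) (≤-trans (m≤m+n ((m + k) C k) ((m + k) C suc k))
  (≤-reflexive (trans (nCk+nC[k+1]≡[n+1]C[k+1] (m + k) k) (cong (_C suc k) (sym (+-suc m k))))))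

G-transfer-≤ : ∀ {n} u d I {v w : Vec ℕ n} {x y x′ y′} → Transfer x y x′ y′ v w →
  x + y ≡ x′ + y′ → x * y ≤ x′ * y′ → G u d I v ≤ G u d I w
G-transfer-≤ u d I tr same-sum more-product = ∑<-mono (suc I) (λ i →
  let (_ , ins , ins′) = Transfer-shift i tr in
  prodEval-transfer-≤ ins ins′ (shift-sum i same-sum) (shift-product i same-sum more-product) (layerWeight u d i))

G-transfer-< : ∀ {n} u d I {v w : Vec ℕ n} {x y x′ y′} → Transfer x y x′ y′ v w →
  x + y ≡ x′ + y′ → x * y < x′ * y′ → G u d I v < G u d I w
G-transfer-< u d I tr same-sum more-product =
  +-mono-<-≤ (let (r , ins , ins′) = Transfer-shift 0 tr in
              prodEval-transfer-< ins ins′ same-sum more-product (layerWeight u d 0)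
                (≤-trans (1≤C d (length r)) (prodEval-≥ r (layerWeight u d 0))))
             (∑<-mono I (λ i →
                let (_ , ins , ins′) = Transfer-shift (suc i) tr in
                prodEval-transfer-≤ ins ins′ (shift-sum (suc i) same-sum) (shift-product (suc i) same-sum (<⇒≤ more-product))
                  (layerWeight u d (suc i))))

moveUnit : ∀ {n} → Vec ℕ n → Fin n → Fin n → Vec ℕ n
moveUnit v p q = updateAt (updateAt v p pred) q suc

moveUnit-transfer : ∀ {n} (v : Vec ℕ n) p q → p ≢ q →
  Transfer (lookup v p) (lookup v q) (pred (lookup v p)) (suc (lookup v q)) v (moveUnit v p q)
moveUnit-transfer v p q p≢q = Insert₂-updateAt v p q pred suc p≢q

unit-sum : ∀ {x} y → 0 < x → x + y ≡ pred x + suc y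
unit-sum {suc x} y _ = sym (+-suc x y)

unit-product : ∀ {x y} → y < x → x * y ≤ pred x * suc y
unit-product {suc x} {y} (s≤s y≤x) = subst (suc x * y ≤_) (sym (*-suc x y)) (+-monoˡ-≤ (x * y) y≤x)

unit-product-< : ∀ {x y} → suc y < x → x * y < pred x * suc y
unit-product-< {suc x} {y} (s≤s y<x) = subst (suc x * y <_) (sym (*-suc x y)) (+-monoˡ-< (x * y) y<x)

overflow-updateAt : ∀ {n} (a b : Vec ℕ n) p (f : ℕ → ℕ) →
  overflow a (updateAt b p f) + (lookup b p ∸ lookup a p) ≡ overflow a b + (f (lookup b p) ∸ lookup a p)
overflow-updateAt (x ∷ a) (y ∷ b) zero    f = +-Comm.xy∙z≈zy∙x (f y ∸ x) (overflow a b) (y ∸ x)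
overflow-updateAt (x ∷ a) (y ∷ b) (suc p) f =
  trans (+-assoc (y ∸ x) _ _) (trans (cong ((y ∸ x) +_) (overflow-updateAt a b p f)) (sym (+-assoc (y ∸ x) _ _)))

-- Σ (bₖ ∸ aₖ) + Σ aₖ = Σ max(aₖ, bₖ) is symmetric in a and b.
overflow-balance : ∀ {n} (a b : Vec ℕ n) → overflow a b + ∣ a ∣ᵥ ≡ overflow b a + ∣ b ∣ᵥ
overflow-balance []      []      = refl
overflow-balance (x ∷ a) (y ∷ b) = begin
  (y ∸ x) + overflow a b + (x + ∣ a ∣ᵥ)    ≡⟨ regroup (y ∸ x) (overflow a b) x ∣ a ∣ᵥ ⟩
  ((y ∸ x) + x) + (overflow a b + ∣ a ∣ᵥ)  ≡⟨ cong₂ _+_ (max-sym x y) (overflow-balance a b) ⟩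
  ((x ∸ y) + y) + (overflow b a + ∣ b ∣ᵥ)  ≡⟨ sym (regroup (x ∸ y) (overflow b a) y ∣ b ∣ᵥ) ⟩
  (x ∸ y) + overflow b a + (y + ∣ b ∣ᵥ)    ∎
  where
  regroup : ∀ p o x s → p + o + (x + s) ≡ (p + x) + (o + s)
  regroup = solve-∀
  max-sym : ∀ x y → (y ∸ x) + x ≡ (x ∸ y) + y
  max-sym x y with ≤-total x y
  ... | inj₁ x≤y = trans (m∸n+n≡m x≤y) (cong (_+ y) (sym (m≤n⇒m∸n≡0 x≤y)))
  ... | inj₂ y≤x = trans (cong (_+ x) (m≤n⇒m∸n≡0 y≤x)) (sym (m∸n+n≡m y≤x))

overflow-positive : ∀ {n} (a b : Vec ℕ n) N → overflow a b ≡ suc N → Σ (Fin n) λ p → lookup a p < lookup b p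
overflow-positive []      []      N ()
overflow-positive (x ∷ a) (y ∷ b) N eq with x <? y
... | yes x<y = zero , x<y
... | no  x≮y = let (p , lt) = overflow-positive a b N (trans (cong (_+ overflow a b) (sym (m≤n⇒m∸n≡0 (≮⇒≥ x≮y)))) eq)
                in suc p , lt

overflow-antisym : ∀ {n} (a b : Vec ℕ n) → overflow a b ≡ 0 → overflow b a ≡ 0 → a ≡ b
overflow-antisym []      []      _  _  = refl
overflow-antisym (x ∷ a) (y ∷ b) ab ba =
  cong₂ _∷_ (≤-antisym (m∸n≡0⇒m≤n (m+n≡0⇒m≡0 (x ∸ y) ba)) (m∸n≡0⇒m≤n (m+n≡0⇒m≡0 (y ∸ x) ab)))
            (overflow-antisym a b (m+n≡0⇒n≡0 (y ∸ x) ab) (m+n≡0⇒n≡0 (x ∸ y) ba))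

overflow-moveUnit : ∀ {n} (a b : Vec ℕ n) p q → p ≢ q → lookup a p < lookup b p → lookup b q < lookup a q →
  overflow a b ≡ suc (overflow a (moveUnit b p q))
overflow-moveUnit a b p q p≢q ap<bp bq<aq = +-cancelʳ-≡ k _ _ (begin
  overflow a b + k                       ≡⟨ sym (overflow-updateAt a b p pred) ⟩
  overflow a b₁ + (lookup b p ∸ lookup a p) ≡⟨ cong (overflow a b₁ +_) (∸-pred ap<bp) ⟩
  overflow a b₁ + suc k                  ≡⟨ +-suc (overflow a b₁) k ⟩
  suc (overflow a b₁) + k                ≡⟨ cong (λ z → suc z + k) (sym raise-q) ⟩
  suc (overflow a (moveUnit b p q)) + k  ∎)
  where
  b₁ = updateAt b p pred
  k = pred (lookup b p) ∸ lookup a p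
  ∸-pred : ∀ {y x} → y < x → x ∸ y ≡ suc (pred x ∸ y)
  ∸-pred {x = suc x} (s≤s y≤x) = +-∸-assoc 1 y≤x
  b₁q : lookup b₁ q ≡ lookup b q
  b₁q = lookup∘updateAt′ q p (p≢q ∘ sym) b
  -- coordinate q stays below aq, so raising it does not change the surplus
  raise-q : overflow a (moveUnit b p q) ≡ overflow a b₁
  raise-q = begin
    overflow a (moveUnit b p q)                                ≡⟨ sym (+-identityʳ _) ⟩
    overflow a (moveUnit b p q) + 0                            ≡⟨ cong (overflow a (moveUnit b p q) +_) (sym (m≤n⇒m∸n≡0 (≤-trans (≤-reflexive b₁q) (<⇒≤ bq<aq)))) ⟩
    overflow a (moveUnit b p q) + (lookup b₁ q ∸ lookup a q)   ≡⟨ overflow-updateAt a b₁ q suc ⟩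
    overflow a b₁ + (suc (lookup b₁ q) ∸ lookup a q)           ≡⟨ cong (overflow a b₁ +_) (m≤n⇒m∸n≡0 (subst (λ z → suc z ≤ lookup a q) (sym b₁q) bq<aq)) ⟩
    overflow a b₁ + 0                                          ≡⟨ +-identityʳ _ ⟩
    overflow a b₁                                              ∎

-- A balanced vector maximises G among vectors with the same sum: move units from
-- b towards a, each move keeping the sum and not decreasing G.
balanced⇒maximal : ∀ {n} u d I (a : Vec ℕ n) → Balanced a → ∀ b → ∣ b ∣ᵥ ≡ ∣ a ∣ᵥ → G u d I b ≤ G u d I a
balanced⇒maximal u d I a balanced b same = go (overflow a b) b same refl
  where
  symmetric : ∀ b → ∣ b ∣ᵥ ≡ ∣ a ∣ᵥ → overflow b a ≡ overflow a b
  symmetric b same = +-cancelʳ-≡ ∣ a ∣ᵥ _ _ (trans (cong (overflow b a +_) (sym same)) (sym (overflow-balance a b)))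
  go : ∀ N b → ∣ b ∣ᵥ ≡ ∣ a ∣ᵥ → overflow a b ≡ N → G u d I b ≤ G u d I a
  go zero    b same surplus = ≤-reflexive (cong (G u d I) (sym (overflow-antisym a b surplus (trans (symmetric b same) surplus))))
  go (suc N) b same surplus
    with overflow-positive a b N surplus | overflow-positive b a N (trans (symmetric b same) surplus)
  ... | p , ap<bp | q , bq<aq =
    ≤-trans (G-transfer-≤ u d I tr same-sum (unit-product bq<bp)) (go N (moveUnit b p q) same′ surplus′)
    where
    bq<bp : lookup b q < lookup b p
    bq<bp = ≤-trans bq<aq (≤-trans (balanced q p) ap<bp)
    p≢q : p ≢ q
    p≢q refl = <-asym ap<bp bq<aq
    tr = moveUnit-transfer b p q p≢q
    same-sum = unit-sum (lookup b q) (≤-trans z<s bq<bp)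
    same′ : ∣ moveUnit b p q ∣ᵥ ≡ ∣ a ∣ᵥ
    same′ = trans (sym (Transfer-sum tr same-sum)) same
    surplus′ : overflow a (moveUnit b p q) ≡ N
    surplus′ = suc-injective (trans (sym (overflow-moveUnit a b p q p≢q ap<bp bq<aq)) surplus)

-- Conversely, if aᵢ > aⱼ + 1 then moving one unit from i to j strictly increases G.
maximal⇒balanced : ∀ {n} u d I (a : Vec ℕ n) → (∀ b → ∣ b ∣ᵥ ≡ ∣ a ∣ᵥ → G u d I b ≤ G u d I a) → Balanced a
maximal⇒balanced u d I a maximal i j with lookup a i ≤? suc (lookup a j)
... | yes ok = ok
... | no  gap = ⊥-elim (<⇒≱ (G-transfer-< u d I tr same-sum (unit-product-< (≰⇒> gap))) (maximal (moveUnit a i j) same))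
  where
  i≢j : i ≢ j
  i≢j refl = gap (n≤1+n _)
  tr = moveUnit-transfer a i j i≢j
  same-sum = unit-sum (lookup a j) (≤-trans z<s (≰⇒> gap))
  same : ∣ moveUnit a i j ∣ᵥ ≡ ∣ a ∣ᵥ
  same = sym (Transfer-sum tr same-sum)

module Size (r n d : ℕ) where

  u I : ℕ
  u = uOf r (suc n)
  I = d / u

  uI≤d : u * I ≤ d
  uI≤d = subst (_≤ d) (*-comm I u) (m/n*n≤m d u)

  layer-room : ∀ i → i ≤ I → i + (d ∸ u * i) ≤ d
  layer-room i i≤I = ≤-trans (+-monoˡ-≤ (d ∸ u * i) (m≤n*m i u)) (≤-reflexive (m+[n∸m]≡n (≤-trans (*-monoʳ-≤ u i≤I) uI≤d)))

  Klist : Vec ℕ (suc n) → List (Vec ℕ (suc n))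
  Klist a = filter (λ c → T? (inK? u d I a c)) (box (a +𝟏 d))

  Klist-unique : ∀ a → Unique (Klist a)
  Klist-unique a = filter⁺ (λ c → T? (inK? u d I a c)) (box-unique (a +𝟏 d))

  Klist-enumerates : ∀ a c → (c ∈ Klist a) ⇔ InK r (suc n) a d c
  Klist-enumerates a c = mk⇔ to from
    where
    to : c ∈ Klist a → InK r (suc n) a d c
    to c∈ =
      let (_ , passes) = ∈-filter⁻ (λ c → T? (inK? u d I a c)) {xs = box (a +𝟏 d)} c∈
          (i , i<1+I , fits) = anyBelow-elim (suc I) _ passes
          (ε , ∣ε∣ , c≺) = overflow-witness (a +𝟏 i) c (d ∸ u * i) (m+n≤o⇒m≤o∸n _ (≤ᵇ⇒≤ _ d fits))
      in i , s≤s⁻¹ i<1+I , ε , ∣ε∣ , c≺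
    from : InK r (suc n) a d c → c ∈ Klist a
    from (i , i≤I , ε , ∣ε∣ , c≺) =
      ∈-filter⁺ (λ c → T? (inK? u d I a c))
        (box-complete (a +𝟏 d) c (≺-box i (d ∸ u * i) d a ε c c≺ (≤-reflexive ∣ε∣) (layer-room i i≤I)))
        (anyBelow-intro (suc I) _ i (s≤s i≤I) (≤⇒≤ᵇ fits))
      where
      fits : overflow (a +𝟏 i) c + u * i ≤ d
      fits = ≤-trans (+-monoˡ-≤ (u * i) (≤-trans (overflow-≤ (a +𝟏 i) ε c c≺) (≤-reflexive ∣ε∣)))
                     (≤-reflexive (m∸n+n≡m (≤-trans (*-monoʳ-≤ u i≤I) uI≤d)))

  Klist-length : ∀ a → length (Klist a) ≡ G u d I a
  Klist-length a = begin
    length (Klist a)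
      ≡⟨ length-filter (inK? u d I a) (box B) ⟩
    sum (map (λ c → 𝟙 (inK? u d I a c)) (box B))
      ≡⟨ sum-map-cong (box B) (λ c → 𝟙-inK? u d I a c uI≤d) ⟩
    sum (map (λ c → ∑< (suc I) (λ i → layer i c)) (box B))
      ≡⟨ sum-map-∑< (box B) (suc I) (λ c i → layer i c) ⟩
    ∑< (suc I) (λ i → sum (map (layer i) (box B)))
      ≡⟨ ∑<-cong (suc I) (λ i i<1+I → trans (count-layer i (s≤s⁻¹ i<1+I))
                                        (prodEval-cong (toList (a +𝟏 i)) (tupleSum-layerTest u d i))) ⟩
    G u d I a ∎
    where
    B = a +𝟏 d
    layer : ℕ → Vec ℕ (suc n) → ℕ
    layer i c = layerTest u d i (reach (a +𝟏 i) c) (overflow (a +𝟏 i) c)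
    count-layer : ∀ i → i ≤ I →
      sum (map (layer i) (box B)) ≡ prodEval (toList (a +𝟏 i)) (λ h → tupleSum (d ∸ u * i) h (layerTest u d i h))
    count-layer i i≤I = sum-box-statistics (d ∸ u * i) B (a +𝟏 i) (layerTest u d i)
      (+𝟏-room a i (d ∸ u * i) d (layer-room i i≤I)) (layerTest-vanish u d i)

  -- G(a) is the closed formula: expand each layer in elementary symmetric
  -- polynomials; in the layers i ≥ 1 the weights of degrees j ≤ u vanish.
  G≡Kformula : ∀ a → G u d I a ≡ Kformula r (suc n) a d
  G≡Kformula a = cong₂ _+_ base-layer (trans (∑<-cong I (λ i _ → upper-layer i)) (sym (sum-map-upTo I _)))
    where
    N = suc n
    base-layer : prodEval (toList (a +𝟏 0)) (layerWeight u d 0) ≡ ∑[ 0 , N ] (λ j → ((d + j) C j) * σ (N ∸ j) a)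
    base-layer = begin
      prodEval (toList (a +𝟏 0)) (λ h → (d + h) C h)      ≡⟨ prodEval-σ (a +𝟏 0) (λ h → (d + h) C h) ⟩
      ∑< (suc N) (λ j → ((d + j) C j) * σ (N ∸ j) (a +𝟏 0))  ≡⟨ cong (λ v → ∑< (suc N) (λ j → ((d + j) C j) * σ (N ∸ j) v)) (map-id a) ⟩
      ∑< (suc N) (λ j → ((d + j) C j) * σ (N ∸ j) a)        ≡⟨ sym (sum-map-upTo (suc N) (λ j → ((d + j) C j) * σ (N ∸ j) a)) ⟩
      ∑[ 0 , N ] (λ j → ((d + j) C j) * σ (N ∸ j) a)      ∎
    gap term : ℕ → ℕ → ℕ
    gap i j = ((d ∸ u * i) + j) C j ∸ ((d ∸ u * i) + u) C j
    term i j = gap i j * σ (N ∸ j) (a +𝟏 i)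
    upper-layer : ∀ i → prodEval (toList (a +𝟏 suc i)) (layerWeight u d (suc i)) ≡ ∑[ suc u , N ] (term (suc i))
    upper-layer i = begin
      prodEval (toList (a +𝟏 suc i)) (layerWeight u d (suc i))
        ≡⟨ prodEval-σ (a +𝟏 suc i) (layerWeight u d (suc i)) ⟩
      ∑< (suc N) (λ j → layerWeight u d (suc i) j * σ (N ∸ j) (a +𝟏 suc i))
        ≡⟨ ∑<-drop (suc N) (suc u) (λ j → layerWeight u d (suc i) j * σ (N ∸ j) (a +𝟏 suc i))
             (λ j j≤u → cong (λ z → z * gap (suc i) j * σ (N ∸ j) (a +𝟏 suc i)) (𝟙-false (<⇒≱ j≤u ∘ <ᵇ⇒< u j))) ⟩
      ∑< (N ∸ u) (λ t → layerWeight u d (suc i) (suc u + t) * σ (N ∸ (suc u + t)) (a +𝟏 suc i))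
        ≡⟨ ∑<-cong (N ∸ u) (λ t _ → cong (_* σ (N ∸ (suc u + t)) (a +𝟏 suc i))
             (trans (cong (_* gap (suc i) (suc u + t)) (𝟙-true (<⇒<ᵇ (s≤s (m≤m+n u t))))) (+-identityʳ _))) ⟩
      ∑< (N ∸ u) (λ t → term (suc i) (suc u + t))
        ≡⟨ sym (sum-map-upTo (N ∸ u) (λ t → term (suc i) (suc u + t))) ⟩
      ∑[ suc u , N ] (term (suc i)) ∎

  K-size : ∀ a → KHasSize r (suc n) a d (Kformula r (suc n) a d)
  K-size a = Klist a , Klist-unique a , Klist-enumerates a , trans (Klist-length a) (G≡Kformula a)

  size≡G : ∀ a k → KHasSize r (suc n) a d k → k ≡ G u d I a
  size≡G a k has-k = trans (KHasSize-unique {r} {suc n} {a} {d} has-k (K-size a)) (sym (G≡Kformula a))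

  maximal⇔balanced : ∀ a →
    (∀ (b : Vec ℕ (suc n)) → ∣ b ∣ᵥ ≡ ∣ a ∣ᵥ → ∀ k m → KHasSize r (suc n) b d k → KHasSize r (suc n) a d m → k ≤ m)
    ⇔ Balanced a
  maximal⇔balanced a = mk⇔
    (λ maximal → maximal⇒balanced u d I a (λ b same →
       subst₂ _≤_ (size≡G b _ (K-size b)) (size≡G a _ (K-size a)) (maximal b same _ _ (K-size b) (K-size a))))
    (λ balanced b same k m has-k has-m →
       subst₂ _≤_ (sym (size≡G b k has-k)) (sym (size≡G a m has-m)) (balanced⇒maximal u d I a balanced b same))

lemma2 : (r n s d : ℕ) → .{{_ : NonZero r}} → n ≥ r → d ≤ s / r →
    ((a : Vec ℕ n) → ∣ a ∣ᵥ ≡ s ∸ r * d → KHasSize r n a d (Kformula r n a d))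
    × ((a : Vec ℕ n) → ∣ a ∣ᵥ ≡ s ∸ r * d →
        ((∀ (b : Vec ℕ n) → ∣ b ∣ᵥ ≡ ∣ a ∣ᵥ → ∀ k m → KHasSize r n b d k → KHasSize r n a d m → k ≤ m)
          ⇔ Balanced a))
lemma2 r zero    s d r≤0 _ = ⊥-elim (≢-nonZero⁻¹ r (n≤0⇒n≡0 r≤0))
lemma2 r (suc n) s d _   _ = (λ a _ → Size.K-size r n d a) , (λ a _ → Size.maximal⇔balanced r n d a)
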